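{- Let $\mathcal{A}$ be a weighted pushdown system with integer weight function $w$, state set $Q$ and stack alphabet $\Gamma$. Let $\ell=|\Gamma|\cdot|Q|$ and $\epsilon=\frac{1}{\ell^{(\ell+1)^2}\cdot 2\cdot\ell}$. For $r\in\mathbb{Q}$ let $\mathcal{A}^{r}$ denote the same system with weight function $w+r$ (every edge weight increased by $r$). Then $\mathcal{A}^{\epsilon}$ has a good cycle if and only if for every $\delta>0$ the system $\mathcal{A}^{\delta}$ has a good cycle.
   Context: A weighted pushdown system (WPS) is $\mathcal{A}=\langle Q,\Gamma,q_0,E,w\rangle$: finite states $Q$, initial state $q_0$, finite stack alphabet $\Gamma$ with bottom symbol $\bot$ (never pushed or popped), finite edge set $E\subseteq(Q\times\Gamma)\times(Q\times\mathrm{Com}(\Gamma))$ with $\mathrm{Com}(\Gamma)=\{\mathit{skip},\mathit{pop}\}\cup\{\mathit{push}(z)\mid z\in\Gamma\}$, and a weight function $w$ (here rational weights are allowed for the shifted systems). Configurations are $(\alpha,q)$, $\alpha\in\Gamma^+$ (last symbol is the top); $(\alpha',q')$ is a successor of $(\alpha,q)$ if some edge $(q,\gamma,q',\mathit{com})$ has $\gamma$ the top of $\alpha$ and $\alpha'=\mathit{com}(\alpha)$. A path is a sequence of configurations each a successor of the previous; its weight is the sum of edge weights. A configuration $(\alpha_i,q_i)$ in a path is a local minimum if $\alpha_i$ is a prefix of the stack string of every later configuration of the path. A good cycle is a finite path $\langle c_1,\dots,c_n\rangle$, $c_k=(\alpha_k,q_k)$, of positive weight such that $c_1$ is a local minimum,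 $q_1=q_n$, and $\alpha_1$ and $\alpha_n$ have the same top symbol; a system "has a good cycle" if some finite path in it is a good cycle. -}

module Defs where

open import Data.Nat as ℕ using (ℕ; zero; suc; _^_)
open import Data.Nat.Properties using (m*n≢0; m^n≢0)
open import Data.Fin using (Fin)
open import Data.Integer using (ℤ)
open import Data.Rational as ℚ using (ℚ; 0ℚ; _+_; _<_)
open import Data.List using (List; []; _∷_; _++_; _∷ʳ_)
open import Data.List.Membership.Propositional using (_∈_)
open import Data.List.Relation.Unary.All using (All)
open import Data.Product using (Σ; ∃; _×_; _,_)
open import Relation.Binary.PropositionalEquality using (_≡_; _≢_)

data Com (Γ : Set) : Set where
  skip : Com Γ
  pop  : Com Γ
  push : Γ → Com Γ

record Edge (nQ nΓ : ℕ) : Set where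
  constructor edge
  field
    src : Fin nQ
    top : Fin nΓ
    tgt : Fin nQ
    com : Com (Fin nΓ)
open Edge public

record PDS : Set where
  field
    nQ     : ℕ
    nΓ     : ℕ
    q0     : Fin nQ
    bot    : Fin nΓ
    E      : List (Edge nQ nΓ)
    noPushBot : ∀ {e} → e ∈ E → com e ≢ push bot
    noPopBot  : ∀ {e} → e ∈ E → top e ≡ bot → com e ≢ pop
open PDS public

record WPS (W : Set) : Set where
  constructor wps
  field
    sys : PDS
    w   : Edge (nQ sys) (nΓ sys) → W
open WPS public

module _ (A : PDS) where

  Stack : Set
  Stack = List (Fin (nΓ A))     -- the last symbol is the top

  Config : Set
  Config = Stack × Fin (nQ A)

  data Step : Edge (nQ A) (nΓ A) → Config → Config → Set where
    step-skip : ∀ {q γ q'} (α : Stack) → edge q γ q' skip ∈ E A →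
                Step (edge q γ q' skip) (α ∷ʳ γ , q) (α ∷ʳ γ , q')
    step-pop  : ∀ {q γ q'} (α : Stack) (β : Fin (nΓ A)) → edge q γ q' pop ∈ E A →
                Step (edge q γ q' pop) ((α ∷ʳ β) ∷ʳ γ , q) (α ∷ʳ β , q')
    step-push : ∀ {q γ q' z} (α : Stack) → edge q γ q' (push z) ∈ E A →
                Step (edge q γ q' (push z)) (α ∷ʳ γ , q) ((α ∷ʳ γ) ∷ʳ z , q')

  data Path : Config → Config → Set where
    []  : ∀ {c} → Path c c
    _∷_ : ∀ {e c c' c''} → Step e c c' → Path c' c'' → Path c c''

  laterStacks : ∀ {c c'} → Path c c' → List Stack
  laterStacks [] = []
  laterStacks (_∷_ {c' = c'} s p) = Data.Product.proj₁ c' ∷ laterStacks p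

  IsPrefixOf : Stack → Stack → Set
  IsPrefixOf α α' = ∃ λ β → α' ≡ α ++ β

  SameTop : Stack → Stack → Set
  SameTop α α' = ∃ λ γ → Σ Stack λ a → Σ Stack λ b → α ≡ a ∷ʳ γ × α' ≡ b ∷ʳ γ

module _ (A : WPS ℚ) where

  weight : ∀ {c c'} → Path (sys A) c c' → ℚ
  weight [] = 0ℚ
  weight (_∷_ {e = e} s p) = w A e + weight p

  record GoodCycle : Set where
    field
      α₁ αₙ : Stack (sys A)
      q     : Fin (nQ (sys A))
      path  : Path (sys A) (α₁ , q) (αₙ , q)
      positive  : 0ℚ < weight path
      localMin  : All (IsPrefixOf (sys A) α₁) (laterStacks (sys A) path)
      sameTop   : SameTop (sys A) α₁ αₙ

  HasGoodCycle : Set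
  HasGoodCycle = GoodCycle

shift : WPS ℤ → ℚ → WPS ℚ
shift A r = wps (sys A) (λ e → (w A e ℚ./ 1) + r)

ell : PDS → ℕ
ell A = nΓ A ℕ.* nQ A

-- ε = 1 / (ℓ^((ℓ+1)^2) · 2 · ℓ).  (ℓ ≥ 1 always holds since q0 ∈ Q and
-- bot ∈ Γ; the ℓ = 0 clause is unreachable for actual systems.)
epsilonOf : ℕ → ℚ
epsilonOf zero = 0ℚ
epsilonOf (suc k) =
  ℚ._/_ (Data.Integer.+ 1) ((ℓ ^ ((ℓ ℕ.+ 1) ^ 2)) ℕ.* 2 ℕ.* ℓ)
    {{m*n≢0 ((ℓ ^ ((ℓ ℕ.+ 1) ^ 2)) ℕ.* 2) ℓ
       {{m*n≢0 (ℓ ^ ((ℓ ℕ.+ 1) ^ 2)) 2 {{m^n≢0 ℓ ((ℓ ℕ.+ 1) ^ 2)}}}}}}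
  where ℓ = suc k

epsilon : WPS ℤ → ℚ
epsilon A = epsilonOf (ell (sys A))

module Submission where

-- Only "⇒" has content.  A good cycle is the same thing as a climb from a
-- state and top symbol back to themselves: a derivation whose pushes are
-- matched by pops inside nested blocks or never popped (Derivation, Paths).
-- For δ = (1+p)/(1+q) its shifted weight has the sign of the integer
-- W·(1+q) + n·(1+p), W its weight and n its length (ScaledWeight,
-- RationalWeight).  By a counting argument every derivation either is
-- repetition-free, hence of length ≤ M = 1/ε, or contains a loop of length
-- ≤ M that can be pumped (Counting, Decomposition, EpsilonBound).  So an
-- ε-positive cycle is either short, and then W ≥ 0 and W + n > 0 make it
-- δ-positive, or splits into a loop and a shorter remainder: either the
-- remainder is ε-positive (recurse) or the loop is, and then it has weight
-- ≥ 0 and pumping it often enough makes the cycle δ-positive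
-- (PositiveCycles).

open import Defs
open import Data.Nat using (ℕ; suc)
open import Data.Integer using (ℤ)

-- Weights of edge lists and pump families: the bookkeeping for inserting a
-- loop into a derivation any number of times.
module WeightSum where

  open import Data.Nat as ℕ using (ℕ; zero; suc; _≤_)
  open import Data.Integer as ℤ using (ℤ; +_; _+_; _*_)
  import Data.Integer.Properties as ℤP
  open import Data.Integer.Tactic.RingSolver using (solve-∀)
  open import Data.List using (List; []; _∷_; _++_; length)
  open import Relation.Binary.PropositionalEquality

  wsum : {E : Set} → (E → ℤ) → List E → ℤ
  wsum f []       = + 0
  wsum f (e ∷ es) = f e + wsum f es

  wsum-++ : {E : Set} (f : E → ℤ) (xs ys : List E) → wsum f (xs ++ ys) ≡ wsum f xs + wsum f ys
  wsum-++ f []       ys = sym (ℤP.+-identityˡ _)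
  wsum-++ f (x ∷ xs) ys = trans (cong (_+_ (f x)) (wsum-++ f xs ys)) (sym (ℤP.+-assoc (f x) _ _))

  -- Under the constant weighting 1 the weight of a list is its length; this
  -- lets every weight identity below double as a length identity.
  wsum-one : {E : Set} (xs : List E) → wsum (λ _ → + 1) xs ≡ + length xs
  wsum-one []       = refl
  wsum-one (x ∷ xs) = cong (_+_ (+ 1)) (wsum-one xs)

  wsum-length : ∀ {E : Set} {xs ys zs : List E} → (∀ (f : E → ℤ) → wsum f xs ≡ wsum f ys + wsum f zs) →
                length xs ≡ length ys ℕ.+ length zs
  wsum-length {xs = xs} {ys} {zs} eq = ℤP.+-injective (begin
    + length xs                                   ≡⟨ sym (wsum-one xs) ⟩
    wsum (λ _ → + 1) xs                           ≡⟨ eq (λ _ → + 1) ⟩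
    wsum (λ _ → + 1) ys + wsum (λ _ → + 1) zs     ≡⟨ cong₂ _+_ (wsum-one ys) (wsum-one zs) ⟩
    + length ys + + length zs                     ≡⟨ sym (ℤP.pos-+ (length ys) (length zs)) ⟩
    + (length ys ℕ.+ length zs)                   ∎)
    where open ≡-Reasoning

  -- A pump family for an object x (a derivation, say) whose edges are listed by
  -- ed: a sequence of objects whose edge multisets are those of x with the
  -- loop EO inserted k - 1 times.  Multisets are compared through their weight
  -- under every weighting.
  record PumpFamily {E T : Set} (ed : T → List E) (B : ℕ) (x : T) : Set where
    field
      member   : ℕ → T
      loop     : List E
      grow     : ∀ (f : E → ℤ) k → wsum f (ed (member (suc k))) ≡ wsum f loop + wsum f (ed (member k))
      original : ∀ (f : E → ℤ) → wsum f (ed (member 1)) ≡ wsum f (ed x)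
      nonempty : 1 ≤ length loop
      short    : length loop ≤ B

    member-wsum : ∀ (f : E → ℤ) k → wsum f (ed (member k)) ≡ + k * wsum f loop + wsum f (ed (member 0))
    member-wsum f zero    = sym (ℤP.+-identityˡ _)
    member-wsum f (suc k) = begin
        wsum f (ed (member (suc k)))                       ≡⟨ grow f k ⟩
        wsum f loop + wsum f (ed (member k))               ≡⟨ cong (_+_ (wsum f loop)) (member-wsum f k) ⟩
        wsum f loop + (+ k * wsum f loop + wsum f (ed (member 0)))
                                                           ≡⟨ distribute (wsum f loop) (+ k) (wsum f (ed (member 0))) ⟩
        + suc k * wsum f loop + wsum f (ed (member 0))     ∎
      where
        open ≡-Reasoning
        distribute : ∀ a k r → a + (k * a + r) ≡ (+ 1 + k) * a + r
        distribute = solve-∀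

    member-length : ∀ k → length (ed (member k)) ≡ k ℕ.* length loop ℕ.+ length (ed (member 0))
    member-length k = ℤP.+-injective (begin
        + length (ed (member k))                            ≡⟨ sym (wsum-one (ed (member k))) ⟩
        wsum one (ed (member k))                            ≡⟨ member-wsum one k ⟩
        + k * wsum one loop + wsum one (ed (member 0))      ≡⟨ cong₂ (λ a b → + k * a + b) (wsum-one loop) (wsum-one (ed (member 0))) ⟩
        + k * + length loop + + length (ed (member 0))      ≡⟨ cong (_+ + length (ed (member 0))) (sym (ℤP.pos-* k (length loop))) ⟩
        + (k ℕ.* length loop) + + length (ed (member 0))    ≡⟨ sym (ℤP.pos-+ (k ℕ.* length loop) (length (ed (member 0)))) ⟩
        + (k ℕ.* length loop ℕ.+ length (ed (member 0)))    ∎)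
      where
        open ≡-Reasoning
        one : E → ℤ
        one _ = + 1

    split-wsum : ∀ (f : E → ℤ) → wsum f (ed x) ≡ wsum f loop + wsum f (ed (member 0))
    split-wsum f = trans (sym (original f)) (grow f 0)

    split-length : length (ed x) ≡ length loop ℕ.+ length (ed (member 0))
    split-length = wsum-length {xs = ed x} {loop} {ed (member 0)} split-wsum

  embed : ∀ {E T T' : Set} {ed : T → List E} {ed' : T' → List E} {B x}
    (h : T → T') (P S : List E) → (∀ y → ed' (h y) ≡ P ++ ed y ++ S) →
    PumpFamily ed B x → PumpFamily ed' B (h x)
  embed {ed = ed} {ed'} {x = x} h P S wrap F = record
    { member   = λ k → h (member k)
    ; loop     = loop
    ; grow     = λ f k → begin
        wsum f (ed' (h (member (suc k))))                        ≡⟨ wrapped f _ ⟩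
        wsum f P + (wsum f (ed (member (suc k))) + wsum f S)     ≡⟨ cong (λ z → wsum f P + (z + wsum f S)) (grow f k) ⟩
        wsum f P + ((wsum f loop + wsum f (ed (member k))) + wsum f S)
                                                                 ≡⟨ shuffle (wsum f P) (wsum f loop) (wsum f (ed (member k))) (wsum f S) ⟩
        wsum f loop + (wsum f P + (wsum f (ed (member k)) + wsum f S))
                                                                 ≡⟨ cong (_+_ (wsum f loop)) (sym (wrapped f _)) ⟩
        wsum f loop + wsum f (ed' (h (member k)))                ∎
    ; original = λ f → trans (wrapped f _)
                  (trans (cong (λ z → wsum f P + (z + wsum f S)) (original f)) (sym (wrapped f x)))
    ; nonempty = nonempty
    ; short    = short
    }
    where
      open PumpFamily F
      open ≡-Reasoning
      shuffle : ∀ a b c d → a + ((b + c) + d) ≡ b + (a + (c + d))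
      shuffle = solve-∀
      wrapped : ∀ f y → wsum f (ed' (h y)) ≡ wsum f P + (wsum f (ed y) + wsum f S)
      wrapped f y = trans (cong (wsum f) (wrap y))
                      (trans (wsum-++ f P _) (cong (_+_ (wsum f P)) (wsum-++ f (ed y) S)))

  iterated : ∀ {E T : Set} {ed : T → List E} {B x} (h : T → T) (y₀ : T) (EO : List E) →
    (∀ (f : E → ℤ) y → wsum f (ed (h y)) ≡ wsum f EO + wsum f (ed y)) → h y₀ ≡ x →
    1 ≤ length EO → length EO ≤ B → PumpFamily ed B x
  iterated {T = T} {ed = ed} h y₀ EO adds hy₀≡x p b = record
    { member = apply ; loop = EO ; grow = λ f k → adds f (apply k)
    ; original = λ f → cong (λ y → wsum f (ed y)) hy₀≡x ; nonempty = p ; short = b }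
    where
      apply : ℕ → T
      apply zero    = y₀
      apply (suc k) = h (apply k)

  prepends : ∀ {E T : Set} (ed : T → List E) (h : T → T) (EO : List E) → (∀ y → ed (h y) ≡ EO ++ ed y) →
             ∀ (f : E → ℤ) y → wsum f (ed (h y)) ≡ wsum f EO + wsum f (ed y)
  prepends ed h EO eq f y = trans (cong (wsum f) (eq y)) (wsum-++ f EO (ed y))

-- Integer arithmetic of shifted weights: scaled weights, and the sign
-- facts used when pumping.
module ScaledWeight where

  open import Data.Nat as ℕ using (ℕ; zero; suc; z≤n; s≤s)
  import Data.Nat.Properties as ℕP
  open import Data.Integer as ℤ using (ℤ; +_; -[1+_]; _+_; _*_; _≤_; _<_; -_; +≤+; +<+; -≤-; ∣_∣)
  import Data.Integer.Properties as ℤP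
  open import Data.Integer.Tactic.RingSolver using (solve-∀)
  open import Data.List using (List; length)
  open import Data.Empty using (⊥-elim)
  open import Relation.Binary.PropositionalEquality
  open WeightSum

  -- The weight of es in the system whose edge weights are shifted by
  -- p / (1 + q), multiplied by 1 + q: an integer with the same sign.
  scaled : {E : Set} → (E → ℤ) → ℤ → ℕ → List E → ℤ
  scaled w p q es = wsum w es * + suc q + + length es * p

  scaled-split : ∀ {E : Set} (w : E → ℤ) p q {xs ys zs : List E} →
                 (∀ (f : E → ℤ) → wsum f xs ≡ wsum f ys + wsum f zs) →
                 scaled w p q xs ≡ scaled w p q ys + scaled w p q zs
  scaled-split w p q {xs} {ys} {zs} split = begin
    wsum w xs * + suc q + + length xs * p
      ≡⟨ cong₂ (λ W n → W * + suc q + + n * p) (split w) (wsum-length {xs = xs} {ys} {zs} split) ⟩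
    (wsum w ys + wsum w zs) * + suc q + + (length ys ℕ.+ length zs) * p
      ≡⟨ cong (λ n → (wsum w ys + wsum w zs) * + suc q + n * p) (ℤP.pos-+ (length ys) (length zs)) ⟩
    (wsum w ys + wsum w zs) * + suc q + (+ length ys + + length zs) * p
      ≡⟨ regroup (wsum w ys) (wsum w zs) (+ suc q) (+ length ys) (+ length zs) p ⟩
    (wsum w ys * + suc q + + length ys * p) + (wsum w zs * + suc q + + length zs * p) ∎
    where
      open ≡-Reasoning
      regroup : ∀ a b c u v r → (a + b) * c + (u + v) * r ≡ (a * c + u * r) + (b * c + v * r)
      regroup = solve-∀

  positive-left : ∀ X Y → + 0 < X + Y → Y ≤ + 0 → + 0 < X
  positive-left X Y pos Y≤0 = ℤP.<-≤-trans pos (ℤP.≤-trans (ℤP.+-monoʳ-≤ X Y≤0) (ℤP.≤-reflexive (ℤP.+-identityʳ X)))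

  -- The sign facts behind pumping, for a weight W and a length n, with 1 + m
  -- in the role of 1/ε.  An ε-positive path of length n ≤ 1 + m cannot have
  -- negative weight.
  nonneg-weight : ∀ W m n → n ℕ.≤ suc m → + 0 < W * + suc m + + n * + 1 → + 0 ≤ W
  nonneg-weight (+ k)    m n n≤ pos = +≤+ z≤n
  nonneg-weight -[1+ k ] m n n≤ pos = ⊥-elim (ℤP.<-irrefl refl (ℤP.<-≤-trans pos nonpositive))
    where
      M : ℤ
      M = + suc m
      weight≤ : -[1+ k ] * M ≤ - M
      weight≤ = ℤP.≤-trans (ℤP.*-monoʳ-≤-nonNeg M {{ℤ.nonNegative (+≤+ z≤n)}} { -[1+ k ] } { -[1+ 0 ] } (-≤- z≤n))
                           (ℤP.≤-reflexive (ℤP.-1*i≡-i M))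
      nonpositive : -[1+ k ] * M + + n * + 1 ≤ + 0
      nonpositive = ℤP.≤-trans (ℤP.+-mono-≤ weight≤ (ℤP.≤-trans (ℤP.≤-reflexive (ℤP.*-identityʳ (+ n))) (+≤+ n≤)))
                               (ℤP.≤-reflexive (ℤP.+-inverseˡ M))

  -- A short ε-positive path is δ-positive for every rational δ = (1+p)/(1+q).
  short-positive : ∀ W m n p q → n ℕ.≤ suc m → + 0 < W * + suc m + + n * + 1 → + 0 < W * + suc q + + n * + suc p
  short-positive -[1+ k ] m n p q n≤ pos with nonneg-weight -[1+ k ] m n n≤ pos
  ... | ()
  short-positive (+ k) m n p q n≤ pos = subst (+ 0 <_) (sym (natural k (suc q) n (suc p))) (+<+ (positive k n pos))
    where
      natural : ∀ k a n b → + k * + a + + n * + b ≡ + (k ℕ.* a ℕ.+ n ℕ.* b)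
      natural k a n b = trans (cong₂ _+_ (sym (ℤP.pos-* k a)) (sym (ℤP.pos-* n b))) (sym (ℤP.pos-+ (k ℕ.* a) (n ℕ.* b)))
      positive : ∀ k n → + 0 < + k * + suc m + + n * + 1 → 0 ℕ.< k ℕ.* suc q ℕ.+ n ℕ.* suc p
      positive (suc k) n _ = s≤s z≤n
      positive zero (suc n) _ = s≤s z≤n
      positive zero zero (+<+ ())

  -- Pumping a loop of nonnegative weight sufficiently often makes the length
  -- term dominate: K = 1 + |W₀ (1 + q)| copies suffice.
  pumpCount : ℤ → ℕ → ℕ
  pumpCount W₀ q = suc ∣ W₀ * + suc q ∣

  pumped-positive : ∀ W₀ WO (n₀ nO p q : ℕ) → + 0 ≤ WO → 1 ℕ.≤ nO →
    let K = pumpCount W₀ q in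
    + 0 < (+ K * WO + W₀) * + suc q + + (K ℕ.* nO ℕ.+ n₀) * + suc p
  pumped-positive W₀ WO n₀ nO p q WO≥0 nO≥1 = begin-strict
    + 0                                       <⟨ plus-abs (W₀ * Q) ⟩
    W₀ * Q + + K                              ≤⟨ ℤP.+-monoʳ-≤ (W₀ * Q) K≤R ⟩
    W₀ * Q + R                                ≤⟨ ℤP.≤-trans (ℤP.≤-reflexive (sym (ℤP.+-identityˡ _))) (ℤP.+-monoˡ-≤ (W₀ * Q + R) loop≥0) ⟩
    (+ K * WO) * Q + (W₀ * Q + R)             ≡⟨ regroup (+ K * WO) W₀ Q R ⟩
    (+ K * WO + W₀) * Q + R                   ∎
    where
      open ℤP.≤-Reasoning
      K : ℕ
      K = pumpCount W₀ q
      Q R : ℤ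
      Q = + suc q
      R = + (K ℕ.* nO ℕ.+ n₀) * + suc p
      plus-abs : ∀ z → + 0 < z + + suc ∣ z ∣
      plus-abs (+ n) = +<+ (ℕP.≤-trans (s≤s z≤n) (ℕP.m≤n+m (suc n) n))
      plus-abs -[1+ n ] = subst (+ 0 <_) (sym (trans (ℤP.⊖-≥ (ℕP.n≤1+n (suc n))) (cong +_ (ℕP.m+n∸n≡m 1 (suc n)))))
                            (+<+ (s≤s z≤n))
      K≤R : + K ≤ R
      K≤R = ℤP.≤-trans (+≤+ (ℕP.≤-trans (ℕP.≤-trans (ℕP.m≤m*n K nO {{ℕ.>-nonZero nO≥1}}) (ℕP.m≤m+n _ n₀)) (ℕP.m≤m*n _ (suc p))))
                       (ℤP.≤-reflexive (ℤP.pos-* (K ℕ.* nO ℕ.+ n₀) (suc p)))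
      nonneg-product : ∀ a b → + 0 ≤ a → + 0 ≤ b → + 0 ≤ a * b
      nonneg-product a b a≥0 b≥0 = ℤP.≤-trans (ℤP.≤-reflexive (sym (ℤP.*-zeroˡ b))) (ℤP.*-monoʳ-≤-nonNeg b {{ℤ.nonNegative b≥0}} a≥0)
      loop≥0 : + 0 ≤ (+ K * WO) * Q
      loop≥0 = nonneg-product (+ K * WO) Q (nonneg-product (+ K) WO (+≤+ z≤n) WO≥0) (+≤+ z≤n)
      regroup : ∀ a b c r → a * c + (b * c + r) ≡ (a + b) * c + r
      regroup = solve-∀

-- The rational weight of an edge list in a shifted system, for integer edge
-- weights w; its sign is that of the scaled weight.
module RationalWeight {E : Set} (w : E → ℤ) where

  open import Data.Integer as ℤ using (ℤ; +_)
  open import Data.Nat using (suc)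
  import Data.Nat.Properties as ℕP
  import Data.Integer.Properties as ℤP
  open import Data.Integer.Tactic.RingSolver using (solve-∀)
  open import Data.Rational as ℚ using (ℚ; 0ℚ; toℚᵘ)
  import Data.Rational.Properties as ℚP
  open import Data.Rational.Unnormalised as ℚᵘ using (ℚᵘ; mkℚᵘ; _≃_; *≡*; *<*)
  import Data.Rational.Unnormalised.Properties as ℚᵘP
  open import Data.Rational.Unnormalised.Solver using (module +-*-Solver)
  open import Data.List using (List; []; _∷_; length)
  open import Relation.Binary.PropositionalEquality
  open WeightSum
  open ScaledWeight

  shiftedWeight : ℚ → List E → ℚ
  shiftedWeight r []       = 0ℚ
  shiftedWeight r (e ∷ es) = ((w e ℚ./ 1) ℚ.+ r) ℚ.+ shiftedWeight r es

  ι : ℤ → ℚᵘ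
  ι z = mkℚᵘ z 0

  ι-+ : ∀ a b → ι (a ℤ.+ b) ≃ ι a ℚᵘ.+ ι b
  ι-+ a b = *≡* (identity a b)
    where identity : ∀ a b → (a ℤ.+ b) ℤ.* + 1 ≡ (a ℤ.* + 1 ℤ.+ b ℤ.* + 1) ℤ.* + 1
          identity = solve-∀

  shifted-linear : ∀ r es → toℚᵘ (shiftedWeight r es) ≃ ι (wsum w es) ℚᵘ.+ ι (+ length es) ℚᵘ.* toℚᵘ r
  shifted-linear r [] = solve 1 (λ R → con ℚᵘ.0ℚᵘ := con ℚᵘ.0ℚᵘ :+ con ℚᵘ.0ℚᵘ :* R) ℚᵘP.≃-refl (toℚᵘ r)
    where open +-*-Solver
  shifted-linear r (e ∷ es) = begin
      toℚᵘ (((w e ℚ./ 1) ℚ.+ r) ℚ.+ shiftedWeight r es)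
    ≈⟨ ℚP.toℚᵘ-homo-+ ((w e ℚ./ 1) ℚ.+ r) (shiftedWeight r es) ⟩
      toℚᵘ ((w e ℚ./ 1) ℚ.+ r) ℚᵘ.+ toℚᵘ (shiftedWeight r es)
    ≈⟨ ℚᵘP.+-cong (ℚᵘP.≃-trans (ℚP.toℚᵘ-homo-+ (w e ℚ./ 1) r) (ℚᵘP.+-congˡ R (ℚP.toℚᵘ-fromℚᵘ (ι (w e)))))
                  (shifted-linear r es) ⟩
      (x ℚᵘ.+ R) ℚᵘ.+ (y ℚᵘ.+ n ℚᵘ.* R)
    ≈⟨ solve 4 (λ x y n R → (x :+ R) :+ (y :+ n :* R) := (x :+ y) :+ (con ℚᵘ.1ℚᵘ :+ n) :* R) ℚᵘP.≃-refl x y n R ⟩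
      (x ℚᵘ.+ y) ℚᵘ.+ (ℚᵘ.1ℚᵘ ℚᵘ.+ n) ℚᵘ.* R
    ≈⟨ ℚᵘP.≃-sym (ℚᵘP.+-cong (ι-+ (w e) (wsum w es)) (ℚᵘP.*-cong (ι-+ (+ 1) (+ length es)) (ℚᵘP.≃-refl {R}))) ⟩
      ι (wsum w (e ∷ es)) ℚᵘ.+ ι (+ length (e ∷ es)) ℚᵘ.* R ∎
    where
      open +-*-Solver
      open ℚᵘP.≃-Reasoning
      x y n R : ℚᵘ
      x = ι (w e)
      y = ι (wsum w es)
      n = ι (+ length es)
      R = toℚᵘ r

  shifted-scaled : ∀ r es p q → toℚᵘ r ≃ mkℚᵘ p q → toℚᵘ (shiftedWeight r es) ≃ mkℚᵘ (scaled w p q es) q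
  shifted-scaled r es p q r≃ =
    ℚᵘP.≃-trans (shifted-linear r es)
      (ℚᵘP.≃-trans (ℚᵘP.+-cong (ℚᵘP.≃-refl {ι (wsum w es)}) (ℚᵘP.*-cong (ℚᵘP.≃-refl {ι (+ length es)}) r≃))
                   (combine (wsum w es) (length es)))
    where
      combine : ∀ W n → ι W ℚᵘ.+ ι (+ n) ℚᵘ.* mkℚᵘ p q ≃ mkℚᵘ (W ℤ.* + suc q ℤ.+ + n ℤ.* p) q
      combine W n rewrite ℕP.+-identityʳ q = *≡* (identity W (+ n) p (+ suc q))
        where identity : ∀ W n p Q → (W ℤ.* Q ℤ.+ (n ℤ.* p) ℤ.* + 1) ℤ.* Q ≡ (W ℤ.* Q ℤ.+ n ℤ.* p) ℤ.* (+ 1 ℤ.* Q)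
              identity = solve-∀

  positive⇒scaled : ∀ r es p q → toℚᵘ r ≃ mkℚᵘ p q → 0ℚ ℚ.< shiftedWeight r es → + 0 ℤ.< scaled w p q es
  positive⇒scaled r es p q r≃ pos with ℚᵘP.<-respʳ-≃ (shifted-scaled r es p q r≃) (ℚP.toℚᵘ-mono-< pos)
  ... | *<* lt = ℤP.<-≤-trans (ℤP.≤-<-trans (ℤP.≤-reflexive (sym (ℤP.*-zeroˡ (+ suc q)))) lt)
                             (ℤP.≤-reflexive (ℤP.*-identityʳ _))

  scaled⇒positive : ∀ r es p q → toℚᵘ r ≃ mkℚᵘ p q → + 0 ℤ.< scaled w p q es → 0ℚ ℚ.< shiftedWeight r es
  scaled⇒positive r es p q r≃ pos = ℚP.toℚᵘ-cancel-< (ℚᵘP.<-respʳ-≃ (ℚᵘP.≃-sym (shifted-scaled r es p q r≃))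
    (*<* (ℤP.<-≤-trans (ℤP.≤-<-trans (ℤP.≤-reflexive (ℤP.*-zeroˡ (+ suc q))) pos)
                       (ℤP.≤-reflexive (sym (ℤP.*-identityʳ _))))))

-- Derivations: the well-nested (push/pop matched) structure of computations
-- that never go below their initial stack.
module Derivation (A : PDS) where

  open import Data.Fin using (Fin; _≟_)
  open import Data.Nat using (suc; _+_)
  open import Data.Nat.Properties using (+-suc)
  open import Data.List using (List; []; _∷_; _++_; length)
  open import Data.List.Properties using (++-assoc; ++-identityʳ; length-++)
  open import Data.List.Membership.Propositional using (_∈_)
  open import Data.Product using (Σ; _×_; _,_)
  open import Data.Product.Properties using (≡-dec)
  open import Data.Unit using (⊤)
  open import Relation.Binary.PropositionalEquality
  open import Relation.Nullary using (¬_; Dec; yes; no)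

  State Sym Ed : Set
  State = Fin (nQ A)
  Sym   = Fin (nΓ A)
  Ed    = Edge (nQ A) (nΓ A)

  -- Run q t r: a computation from state q to state r that starts and ends
  -- with the same stack and never goes below it; t is the top symbol.
  data Run   : State → Sym → State → Set
  data Block : State → Sym → State → Set

  data Run where
    done : ∀ {q t} → Run q t q
    stay : ∀ {q t q' r} → edge q t q' skip ∈ E A → Run q' t r → Run q t r
    nest : ∀ {q t q' r} → Block q t q' → Run q' t r → Run q t r

  data Block where
    block : ∀ {q t p z p' q'} → edge q t p (push z) ∈ E A → Run p z p' →
            edge p' z q' pop ∈ E A → Block q t q'

  -- Climb q t r t': a computation that never goes below its initial stack and
  -- whose pushes are either matched inside a Run or never popped; it starts in
  -- q with top t and ends in r with top t'.
  data Climb : State → Sym → State → Sym → Set where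
    level : ∀ {q t r} → Run q t r → Climb q t r t
    rise  : ∀ {q t p p' z r t'} → Run q t p → edge p t p' (push z) ∈ E A →
            Climb p' z r t' → Climb q t r t'

  edgesR : ∀ {q t r} → Run q t r → List Ed
  edgesB : ∀ {q t r} → Block q t r → List Ed
  edgesR done = []
  edgesR (stay {q} {t} {q'} _ X) = edge q t q' skip ∷ edgesR X
  edgesR (nest B X) = edgesB B ++ edgesR X
  edgesB (block {q} {t} {p} {z} {p'} {q'} _ X _) =
    edge q t p (push z) ∷ (edgesR X ++ edge p' z q' pop ∷ [])

  length-edgesB : ∀ {q t p z p' q'} (m : edge q t p (push z) ∈ E A) (X : Run p z p') (m' : edge p' z q' pop ∈ E A) →
                  length (edgesB (block m X m')) ≡ length (edgesR X) + 2
  length-edgesB m X m' = trans (cong suc (length-++ (edgesR X))) (sym (+-suc (length (edgesR X)) 1))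

  edgesC : ∀ {q t r t'} → Climb q t r t' → List Ed
  edgesC (level X) = edgesR X
  edgesC (rise {q} {t} {p} {p'} {z} X _ U) = edgesR X ++ edge p t p' (push z) ∷ edgesC U

  infixr 5 _++ᴿ_ _++ᶜ_

  _++ᴿ_ : ∀ {a t b c} → Run a t b → Run b t c → Run a t c
  done     ++ᴿ Y = Y
  stay m X ++ᴿ Y = stay m (X ++ᴿ Y)
  nest B X ++ᴿ Y = nest B (X ++ᴿ Y)

  edgesR-++ : ∀ {a t b c} (X : Run a t b) (Y : Run b t c) → edgesR (X ++ᴿ Y) ≡ edgesR X ++ edgesR Y
  edgesR-++ done     Y = refl
  edgesR-++ (stay m X) Y = cong (_ ∷_) (edgesR-++ X Y)
  edgesR-++ (nest B X) Y = trans (cong (edgesB B ++_) (edgesR-++ X Y)) (sym (++-assoc (edgesB B) (edgesR X) (edgesR Y)))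

  _++ᶜ_ : ∀ {a b c d e f} → Climb a b c d → Climb c d e f → Climb a b e f
  level X   ++ᶜ level Y   = level (X ++ᴿ Y)
  level X   ++ᶜ rise Y m V = rise (X ++ᴿ Y) m V
  rise X m U ++ᶜ V         = rise X m (U ++ᶜ V)

  edgesC-++ : ∀ {a b c d e f} (U : Climb a b c d) (V : Climb c d e f) → edgesC (U ++ᶜ V) ≡ edgesC U ++ edgesC V
  edgesC-++ (level X) (level Y) = edgesR-++ X Y
  edgesC-++ (level X) (rise Y m V) = trans (cong (_++ _) (edgesR-++ X Y)) (++-assoc (edgesR X) (edgesR Y) _)
  edgesC-++ (rise X m U) V = trans (cong (λ z → edgesR X ++ _ ∷ z) (edgesC-++ U V))
                               (sym (++-assoc (edgesR X) (_ ∷ edgesC U) (edgesC V)))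

  Label : Set
  Label = State × Sym × State

  _≟ˡ_ : (x y : Label) → Dec (x ≡ y)
  _≟ˡ_ = ≡-dec _≟_ (≡-dec _≟_ _≟_)

  data OccR {q t q'} : ∀ {a b c} → Run a b c → Set
  data OccB {q t q'} : ∀ {a b c} → Block a b c → Set

  data OccR {q t q'} where
    inHead    : ∀ {a b c r} {B : Block a b c} {X : Run c b r} → OccB {q} {t} {q'} B → OccR (nest B X)
    afterStay : ∀ {a b c r} {m : edge a b c skip ∈ E A} {X : Run c b r} → OccR {q} {t} {q'} X → OccR (stay m X)
    afterNest : ∀ {a b c r} {B : Block a b c} {X : Run c b r} → OccR {q} {t} {q'} X → OccR (nest B X)

  data OccB {q t q'} where
    self   : ∀ {B : Block q t q'} → OccB B
    inside : ∀ {a b p z p' c} {m : edge a b p (push z) ∈ E A} {X : Run p z p'} {m' : edge p' z c pop ∈ E A} →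
             OccR {q} {t} {q'} X → OccB (block m X m')

  occR? : ∀ q t q' {a b c} (X : Run a b c) → Dec (OccR {q} {t} {q'} X)
  occB? : ∀ q t q' {a b c} (B : Block a b c) → Dec (OccB {q} {t} {q'} B)
  occR? q t q' done = no (λ ())
  occR? q t q' (stay m X) with occR? q t q' X
  ... | yes o = yes (afterStay o)
  ... | no ¬o = no (λ { (afterStay o) → ¬o o })
  occR? q t q' (nest B X) with occB? q t q' B | occR? q t q' X
  ... | yes o | _     = yes (inHead o)
  ... | no _  | yes o = yes (afterNest o)
  ... | no ¬o | no ¬o' = no (λ { (inHead o) → ¬o o ; (afterNest o) → ¬o' o })
  occB? q t q' {a} {b} {c} (block m X m') with (a , b , c) ≟ˡ (q , t , q')
  ... | yes refl = yes self
  ... | no ne with occR? q t q' X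
  ...   | yes o = yes (inside o)
  ...   | no ¬o = no (λ { self → ne refl ; (inside o) → ¬o o })

  module _ {q : State} {t : Sym} {q' : State} where
    replaceR : ∀ {a b c} (X : Run a b c) → OccR {q} {t} {q'} X → Block q t q' → Run a b c
    replaceB : ∀ {a b c} (B : Block a b c) → OccB {q} {t} {q'} B → Block q t q' → Block a b c
    replaceR (nest B X) (inHead o)    B' = nest (replaceB B o B') X
    replaceR (stay m X) (afterStay o) B' = stay m (replaceR X o B')
    replaceR (nest B X) (afterNest o) B' = nest B (replaceR X o B')
    replaceB B self B' = B'
    replaceB (block m X m') (inside o) B' = block m (replaceR X o B') m'

    extractR : ∀ {a b c} (X : Run a b c) → OccR {q} {t} {q'} X → Block q t q'
    extractB : ∀ {a b c} (B : Block a b c) → OccB {q} {t} {q'} B → Block q t q'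
    extractR (nest B X) (inHead o)    = extractB B o
    extractR (stay m X) (afterStay o) = extractR X o
    extractR (nest B X) (afterNest o) = extractR X o
    extractB B self = B
    extractB (block m X m') (inside o) = extractR X o

    beforeR afterR : ∀ {a b c} (X : Run a b c) → OccR {q} {t} {q'} X → List Ed
    beforeB afterB : ∀ {a b c} (B : Block a b c) → OccB {q} {t} {q'} B → List Ed
    beforeR (nest B X) (inHead o) = beforeB B o
    beforeR (stay {a} {b} {c} m X) (afterStay o) = edge a b c skip ∷ beforeR X o
    beforeR (nest B X) (afterNest o) = edgesB B ++ beforeR X o
    afterR (nest B X) (inHead o)    = afterB B o ++ edgesR X
    afterR (stay m X) (afterStay o) = afterR X o
    afterR (nest B X) (afterNest o) = afterR X o
    beforeB B self = []
    beforeB (block {a} {b} {p} {z} m X m') (inside o) = edge a b p (push z) ∷ beforeR X o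
    afterB B self = []
    afterB (block {z = z} {p' = p'} {q' = c} m X m') (inside o) = afterR X o ++ edge p' z c pop ∷ []

    private
      reassoc : ∀ (a b c d : List Ed) → (a ++ b ++ c) ++ d ≡ a ++ b ++ c ++ d
      reassoc a b c d = trans (++-assoc a (b ++ c) d) (cong (a ++_) (++-assoc b c d))

    replaceR-edges : ∀ {a b c} (X : Run a b c) (o : OccR X) B' →
                     edgesR (replaceR X o B') ≡ beforeR X o ++ edgesB B' ++ afterR X o
    replaceB-edges : ∀ {a b c} (B : Block a b c) (o : OccB B) B' →
                     edgesB (replaceB B o B') ≡ beforeB B o ++ edgesB B' ++ afterB B o
    replaceR-edges (nest B X) (inHead o) B' =
      trans (cong (_++ edgesR X) (replaceB-edges B o B')) (reassoc (beforeB B o) (edgesB B') (afterB B o) (edgesR X))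
    replaceR-edges (stay m X) (afterStay o) B' = cong (_ ∷_) (replaceR-edges X o B')
    replaceR-edges (nest B X) (afterNest o) B' =
      trans (cong (edgesB B ++_) (replaceR-edges X o B')) (sym (++-assoc (edgesB B) (beforeR X o) _))
    replaceB-edges B self B' = sym (++-identityʳ (edgesB B'))
    replaceB-edges (block m X m') (inside o) B' =
      cong (_ ∷_) (trans (cong (_++ _) (replaceR-edges X o B')) (reassoc (beforeR X o) (edgesB B') (afterR X o) _))

    replaceR-extract : ∀ {a b c} (X : Run a b c) (o : OccR X) → replaceR X o (extractR X o) ≡ X
    replaceB-extract : ∀ {a b c} (B : Block a b c) (o : OccB B) → replaceB B o (extractB B o) ≡ B
    replaceR-extract (nest B X) (inHead o)    = cong (λ z → nest z X) (replaceB-extract B o)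
    replaceR-extract (stay m X) (afterStay o) = cong (stay m) (replaceR-extract X o)
    replaceR-extract (nest B X) (afterNest o) = cong (nest B) (replaceR-extract X o)
    replaceB-extract B self = refl
    replaceB-extract (block m X m') (inside o) = cong (λ z → block m z m') (replaceR-extract X o)

  data Visits (s : State) : ∀ {a b c} → Run a b c → Set where
    now       : ∀ {b c} {X : Run s b c} → Visits s X
    laterStay : ∀ {a b c r} {m : edge a b c skip ∈ E A} {X : Run c b r} → Visits s X → Visits s (stay m X)
    laterNest : ∀ {a b c r} {B : Block a b c} {X : Run c b r} → Visits s X → Visits s (nest B X)

  visits? : ∀ s {a b c} (X : Run a b c) → Dec (Visits s X)
  visits? s {a} X with a ≟ s
  ... | yes refl = yes now
  visits? s done | no ne = no (λ { now → ne refl })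
  visits? s (stay m X) | no ne with visits? s X
  ... | yes v = yes (laterStay v)
  ... | no ¬v = no (λ { now → ne refl ; (laterStay v) → ¬v v })
  visits? s (nest B X) | no ne with visits? s X
  ... | yes v = yes (laterNest v)
  ... | no ¬v = no (λ { now → ne refl ; (laterNest v) → ¬v v })

  splitRun : ∀ {s a b c} (X : Run a b c) → Visits s X →
             Σ (Run a b s) λ X₁ → Σ (Run s b c) λ X₂ → X₁ ++ᴿ X₂ ≡ X
  splitRun X now = done , X , refl
  splitRun (stay m X) (laterStay v) with splitRun X v
  ... | X₁ , X₂ , eq = stay m X₁ , X₂ , cong (stay m) eq
  splitRun (nest B X) (laterNest v) with splitRun X v
  ... | X₁ , X₂ , eq = nest B X₁ , X₂ , cong (nest B) eq

  data Passes (s : State) (u : Sym) : ∀ {a b c d} → Climb a b c d → Set where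
    now   : ∀ {c d} {U : Climb s u c d} → Passes s u U
    later : ∀ {a b p p' z c d} {X : Run a b p} {m : edge p b p' (push z) ∈ E A} {U : Climb p' z c d} →
            Passes s u U → Passes s u (rise X m U)

  passes? : ∀ s u {a b c d} (U : Climb a b c d) → Dec (Passes s u U)
  passes? s u {a} {b} U with ≡-dec _≟_ _≟_ (a , b) (s , u)
  ... | yes refl = yes now
  passes? s u (level X) | no ne = no (λ { now → ne refl })
  passes? s u (rise X m U) | no ne with passes? s u U
  ... | yes p = yes (later p)
  ... | no ¬p = no (λ { now → ne refl ; (later p) → ¬p p })

  splitClimb : ∀ {s u a b c d} (U : Climb a b c d) → Passes s u U →
               Σ (Climb a b s u) λ U₁ → Σ (Climb s u c d) λ U₂ → U₁ ++ᶜ U₂ ≡ U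
  splitClimb (level X) now = level done , level X , refl
  splitClimb (rise X m U) now = level done , rise X m U , refl
  splitClimb (rise X m U) (later p) with splitClimb U p
  ... | U₁ , U₂ , eq = rise X m U₁ , U₂ , cong (rise X m) eq

  SimpleR : ∀ {a b c} → Run a b c → Set
  SimpleB : ∀ {a b c} → Block a b c → Set
  SimpleR done = ⊤
  SimpleR (stay {q} m X) = ¬ Visits q X × SimpleR X
  SimpleR (nest {q} B X) = ¬ Visits q X × SimpleB B × SimpleR X
  SimpleB (block {q} {t} {q' = q'} m X m') = ¬ OccR {q} {t} {q'} X × SimpleR X

  SimpleC : ∀ {a b c d} → Climb a b c d → Set
  SimpleC (level X) = SimpleR X
  SimpleC (rise {q} {t} X m U) = ¬ Passes q t U × SimpleR X × SimpleC U

-- Derivations and paths: every derivation is executed by a path, and every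
-- path above its initial stack parses into a climb.
module Paths (A : PDS) where

  import Data.Nat as ℕ
  import Data.Nat.Properties as ℕP
  open import Data.List using (List; []; _∷_; _++_; length; _∷ʳ_)
  open import Data.List.Properties using (++-assoc; ++-identityʳ; ∷ʳ-injective; length-++)
  open import Data.List.Membership.Propositional using (_∈_)
  open import Data.List.Relation.Unary.All as All using (All; []; _∷_)
  open import Data.List.Relation.Unary.All.Properties using (++⁺)
  open import Data.Product using (Σ; ∃; _×_; _,_; proj₂)
  open import Data.Empty using (⊥-elim)
  open import Relation.Binary.PropositionalEquality
  open Derivation A

  St : Set
  St = Stack A

  pathEdges : ∀ {c c'} → Path A c c' → List Ed
  pathEdges [] = []
  pathEdges (_∷_ {e = e} s π) = e ∷ pathEdges π

  infixr 5 _++ᵖ_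
  _++ᵖ_ : ∀ {c c' c''} → Path A c c' → Path A c' c'' → Path A c c''
  [] ++ᵖ ρ = ρ
  (s ∷ π) ++ᵖ ρ = s ∷ (π ++ᵖ ρ)

  pathEdges-++ : ∀ {c c' c''} (π : Path A c c') (ρ : Path A c' c'') → pathEdges (π ++ᵖ ρ) ≡ pathEdges π ++ pathEdges ρ
  pathEdges-++ [] ρ = refl
  pathEdges-++ (s ∷ π) ρ = cong (_ ∷_) (pathEdges-++ π ρ)

  laterStacks-++ : ∀ {c c' c''} (π : Path A c c') (ρ : Path A c' c'') →
                   laterStacks A (π ++ᵖ ρ) ≡ laterStacks A π ++ laterStacks A ρ
  laterStacks-++ [] ρ = refl
  laterStacks-++ (s ∷ π) ρ = cong (_ ∷_) (laterStacks-++ π ρ)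

  prefix-refl : ∀ (x : St) → IsPrefixOf A x x
  prefix-refl x = [] , sym (++-identityʳ x)

  prefix-trans : ∀ {x y z : St} → IsPrefixOf A x y → IsPrefixOf A y z → IsPrefixOf A x z
  prefix-trans {x} (β , refl) (γ , refl) = β ++ γ , ++-assoc x β γ

  -- Above base π: the path π never leaves the stacks extending base, i.e. its
  -- first configuration (when its stack is base) is a local minimum.
  Above : ∀ {c c'} → St → Path A c c' → Set
  Above base π = All (IsPrefixOf A base) (laterStacks A π)

  above-++ : ∀ {base c c' c''} (π : Path A c c') (ρ : Path A c' c'') → Above base π → Above base ρ → Above base (π ++ᵖ ρ)
  above-++ π ρ abπ abρ = subst (All _) (sym (laterStacks-++ π ρ)) (++⁺ abπ abρ)

  above-lower : ∀ {x y : St} {c c'} {π : Path A c c'} → IsPrefixOf A x y → Above y π → Above x π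
  above-lower x≤y = All.map (prefix-trans x≤y)

  realizeR : (a : St) {q : State} {t : Sym} {r : State} (X : Run q t r) →
             Σ (Path A (a ∷ʳ t , q) (a ∷ʳ t , r)) λ π → pathEdges π ≡ edgesR X × Above (a ∷ʳ t) π
  realizeB : (a : St) {q : State} {t : Sym} {r : State} (B : Block q t r) →
             Σ (Path A (a ∷ʳ t , q) (a ∷ʳ t , r)) λ π → pathEdges π ≡ edgesB B × Above (a ∷ʳ t) π
  realizeR a done = [] , refl , []
  realizeR a {t = t} (stay m X) with realizeR a X
  ... | π , e , ab = step-skip a m ∷ π , cong (_ ∷_) e , prefix-refl (a ∷ʳ t) ∷ ab
  realizeR a (nest B X) with realizeB a B | realizeR a X
  ... | π , e , ab | ρ , e' , ab' = π ++ᵖ ρ , trans (pathEdges-++ π ρ) (cong₂ _++_ e e') , above-++ π ρ ab ab'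
  realizeB a {t = t} (block {z = z} m X m') with realizeR (a ∷ʳ t) X
  ... | π , e , ab = step-push a m ∷ (π ++ᵖ (step-pop a t m' ∷ [])) ,
        cong (_ ∷_) (trans (pathEdges-++ π _) (cong (_++ _) e)) ,
        (z ∷ [] , refl) ∷ above-++ π _ (above-lower (z ∷ [] , refl) ab) (prefix-refl (a ∷ʳ t) ∷ [])

  realizeC : (a : St) {q : State} {t : Sym} {r : State} {t' : Sym} (U : Climb q t r t') →
             Σ St λ b → Σ (Path A (a ∷ʳ t , q) (b ∷ʳ t' , r)) λ π → pathEdges π ≡ edgesC U × Above (a ∷ʳ t) π
  realizeC a (level X) with realizeR a X
  ... | π , e , ab = a , π , e , ab
  realizeC a {t = t} (rise {z = z} X m U) with realizeR a X | realizeC (a ∷ʳ t) U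
  ... | π , e , ab | b , ρ , e' , ab' = b , π ++ᵖ (step-push a m ∷ ρ) ,
        trans (pathEdges-++ π _) (cong₂ _++_ e (cong (_ ∷_) e')) ,
        above-++ π _ ab ((z ∷ [] , refl) ∷ above-lower (z ∷ [] , refl) ab')

  -- The parser reads the path
  -- left to right, keeping a Frame of the levels opened by pushes that are
  -- not yet matched (each a run followed by its push) and the run cur of the
  -- current level; a pop closes the current run into a block of the level
  -- below.
  module Parse (q₀ : State) (t₀ : Sym) (a : St) where

    base : St
    base = a ∷ʳ t₀

    data Frame : State → Sym → List Sym → Set where
      bottom : Frame q₀ t₀ []
      opened : ∀ {s u zs p p' z} → Frame s u zs → Run s u p → edge p u p' (push z) ∈ E A →
               Frame p' z (zs ∷ʳ z)

    frameEdges : ∀ {s u zs} → Frame s u zs → List Ed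
    frameEdges bottom = []
    frameEdges (opened {u = u} {p = p} {p' = p'} {z = z} F X m) = frameEdges F ++ (edgesR X ++ edge p u p' (push z) ∷ [])

    close : ∀ {s u zs r t'} → Frame s u zs → Climb s u r t' → Climb q₀ t₀ r t'
    close bottom U = U
    close (opened F X m) U = close F (rise X m U)

    close-edges : ∀ {s u zs r t'} (F : Frame s u zs) (U : Climb s u r t') → edgesC (close F U) ≡ frameEdges F ++ edgesC U
    close-edges bottom U = refl
    close-edges (opened F X m) U = trans (close-edges F (rise X m U))
      (trans (cong (frameEdges F ++_) (sym (++-assoc (edgesR X) (_ ∷ []) (edgesC U)))) (sym (++-assoc (frameEdges F) _ (edgesC U))))

    frame-top : ∀ {s u zs} → Frame s u zs → ∃ λ b → base ++ zs ≡ b ∷ʳ u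
    frame-top bottom = a , ++-identityʳ base
    frame-top (opened {zs = zs} {z = z} F X m) = base ++ zs , sym (++-assoc base zs (z ∷ []))

    reads-top : ∀ {s u zs γ} (F : Frame s u zs) (α : St) → α ∷ʳ γ ≡ base ++ zs → γ ≡ u
    reads-top F α eq with frame-top F
    ... | b , top = proj₂ (∷ʳ-injective α b (trans eq top))

    record Parsed (c' : Config A) (es : List Ed) : Set where
      field
        {zs} : List Sym
        {r}  : State
        {u}  : Sym
        climb  : Climb q₀ t₀ r u
        ends   : c' ≡ (base ++ zs , r)
        topped : ∃ λ b → base ++ zs ≡ b ∷ʳ u
        edges  : edgesC climb ≡ es

    regroup : ∀ {c' es es'} → es ≡ es' → Parsed c' es → Parsed c' es'
    regroup eq P = record { climb = climb ; ends = ends ; topped = topped ; edges = trans edges eq }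
      where open Parsed P

    -- A pop from the stack base itself would leave the stacks above base.
    no-pop-at-base : ∀ {α : St} {β γ δ} → (α ∷ʳ β) ∷ʳ γ ≡ base ++ [] → α ∷ʳ β ≡ base ++ δ → ∀ {X : Set} → X
    no-pop-at-base {α} {β} {γ} {δ} eq above = ⊥-elim (ℕP.<-irrefl refl (ℕP.<-≤-trans shorter longer))
      where
        shorter : length (α ∷ʳ β) ℕ.< length base
        shorter = ℕP.≤-reflexive (trans (sym (trans (length-++ (α ∷ʳ β)) (ℕP.+-comm _ 1)))
                    (trans (cong length eq) (cong length (++-identityʳ base))))
        longer : length base ℕ.≤ length (α ∷ʳ β)
        longer = ℕP.≤-trans (ℕP.m≤m+n (length base) (length δ)) (ℕP.≤-reflexive (trans (sym (length-++ base)) (cong length (sym above))))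

    parse : ∀ {s u zs q c'} (F : Frame s u zs) (cur : Run s u q) {stk : St} (π : Path A (stk , q) c') →
            stk ≡ base ++ zs → Above base π → Parsed c' (frameEdges F ++ edgesR cur ++ pathEdges π)
    parse F cur [] eq _ = record
      { climb = close F (level cur) ; ends = cong (_, _) eq ; topped = frame-top F
      ; edges = trans (close-edges F (level cur)) (cong (frameEdges F ++_) (sym (++-identityʳ _))) }
    parse F cur (step-skip α m ∷ π) eq (_ ∷ ab) with reads-top F α eq
    ... | refl = regroup (cong (frameEdges F ++_) (trans (cong (_++ pathEdges π) (edgesR-++ cur (stay m done)))
                                                         (++-assoc (edgesR cur) _ (pathEdges π))))
                   (parse F (cur ++ᴿ stay m done) π eq ab)
    parse {zs = zs} F cur (step-push {z = z} α m ∷ π) eq (_ ∷ ab) with reads-top F α eq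
    ... | refl = regroup (trans (++-assoc (frameEdges F) _ (pathEdges π)) (cong (frameEdges F ++_) (++-assoc (edgesR cur) _ (pathEdges π))))
                   (parse (opened F cur m) done π (trans (cong (_∷ʳ z) eq) (++-assoc base zs (z ∷ []))) ab)
    parse bottom cur (step-pop α β m ∷ π) eq (above ∷ _) = no-pop-at-base eq (proj₂ above)
    parse (opened {zs = zs} {z = z} F X m') cur (step-pop α β m ∷ π) eq (_ ∷ ab)
      with ∷ʳ-injective (α ∷ʳ β) (base ++ zs) (trans eq (sym (++-assoc base zs (z ∷ []))))
    ... | eq' , refl = regroup (trans (cong (λ l → frameEdges F ++ l ++ pathEdges π) (edgesR-++ X (nest (block m' cur m) done)))
                                     (pop-regroup (frameEdges F) (edgesR X) (edgesR cur) (pathEdges π) _ _))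
                         (parse F (X ++ᴿ nest (block m' cur m) done) π eq' ab)
      where
        pop-regroup : ∀ (F X C P : List Ed) e' e →
          F ++ (X ++ (e' ∷ (C ++ e ∷ [])) ++ []) ++ P ≡ (F ++ (X ++ e' ∷ [])) ++ C ++ e ∷ P
        pop-regroup F X C P e' e = begin
          F ++ (X ++ (e' ∷ (C ++ e ∷ [])) ++ []) ++ P   ≡⟨ cong (λ w → F ++ (X ++ w) ++ P) (++-identityʳ (e' ∷ (C ++ e ∷ []))) ⟩
          F ++ (X ++ e' ∷ (C ++ e ∷ [])) ++ P           ≡⟨ cong (F ++_) (++-assoc X _ P) ⟩
          F ++ X ++ e' ∷ ((C ++ e ∷ []) ++ P)           ≡⟨ cong (λ w → F ++ X ++ e' ∷ w) (++-assoc C (e ∷ []) P) ⟩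
          F ++ X ++ e' ∷ (C ++ e ∷ P)                   ≡⟨ cong (F ++_) (sym (++-assoc X (e' ∷ []) (C ++ e ∷ P))) ⟩
          F ++ (X ++ e' ∷ []) ++ C ++ e ∷ P             ≡⟨ sym (++-assoc F (X ++ e' ∷ []) (C ++ e ∷ P)) ⟩
          (F ++ (X ++ e' ∷ [])) ++ C ++ e ∷ P           ∎
          where open ≡-Reasoning

-- The counting argument: repetition-free derivations are short.
module Counting (A : PDS) where

  open import Data.Nat as ℕ using (ℕ; suc; _≤_; z≤n; s≤s; _+_; _*_; _^_; _∸_; NonZero)
  import Data.Nat.Properties as ℕP
  open import Data.List using (List; []; _∷_; _++_; length; allFin; cartesianProduct)
  open import Data.List.Properties using (length-++; length-map; length-removeAt′; length-tabulate)
  open import Data.List.Membership.Propositional using (_∈_)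
  open import Data.List.Membership.Propositional.Properties using (∈-allFin; ∈-cartesianProduct⁺)
  open import Data.List.Relation.Unary.Any using (here; there; index; _─_)
  open import Data.Product using (_×_; _,_)
  open import Data.Empty using (⊥-elim)
  open import Function using (_∘_)
  open import Relation.Binary.PropositionalEquality
  open Derivation A
  open import Algebra.Properties.CommutativeSemigroup ℕP.*-commutativeSemigroup using (x∙yz≈y∙xz)

  ∈-─ : ∀ {X : Set} {x y : X} {xs : List X} (p : y ∈ xs) → x ∈ xs → x ≢ y → x ∈ (xs ─ p)
  ∈-─ (here refl) (here refl) ne = ⊥-elim (ne refl)
  ∈-─ (here _)    (there q)   ne = q
  ∈-─ (there p)   (here eq)   ne = here eq
  ∈-─ (there p)   (there q)   ne = there (∈-─ p q ne)

  length-─ : ∀ {X : Set} {y : X} (xs : List X) (p : y ∈ xs) → length xs ≡ suc (length (xs ─ p))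
  length-─ xs p = length-removeAt′ xs (index p)

  length-cartesianProduct : ∀ {X Y : Set} (xs : List X) (ys : List Y) →
                            length (cartesianProduct xs ys) ≡ length xs * length ys
  length-cartesianProduct []       ys = refl
  length-cartesianProduct (x ∷ xs) ys = begin
      length (Data.List.map (x ,_) ys ++ cartesianProduct xs ys)      ≡⟨ length-++ (Data.List.map (x ,_) ys) ⟩
      length (Data.List.map (x ,_) ys) + length (cartesianProduct xs ys)
                                                                       ≡⟨ cong₂ _+_ (length-map (x ,_) ys) (length-cartesianProduct xs ys) ⟩
      length ys + length xs * length ys                                ∎
    where open ≡-Reasoning

  d : ℕ
  d = nQ A

  instance
    d≢0 : NonZero d
    d≢0 with nQ A | q0 A
    ... | suc _ | _ = _

  allStates : List State
  allStates = allFin d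

  length-allStates : length allStates ≡ d
  length-allStates = length-tabulate (λ x → x)

  ≤-length* : ∀ {X : Set} {x : X} {xs} → x ∈ xs → ∀ P → P ≤ length xs * P
  ≤-length* {xs = _ ∷ xs} _ P = ℕP.m≤m+n P (length xs * P)

  spend : ∀ {X : Set} {x : X} (xs : List X) (p : x ∈ xs) (h r P : ℕ) → h ≤ P →
          r + P ≤ length (xs ─ p) * P → (h + r) + P ≤ length xs * P
  spend xs p h r P h≤P rest = begin
    (h + r) + P             ≡⟨ ℕP.+-assoc h r P ⟩
    h + (r + P)             ≤⟨ ℕP.+-mono-≤ h≤P rest ⟩
    P + length (xs ─ p) * P ≡⟨ cong (_* P) (sym (length-─ xs p)) ⟩
    length xs * P           ∎
    where open ℕP.≤-Reasoning

  -- The length budget of a repetition-free block whose nested block labels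
  -- are drawn from avL.
  budget : List Label → ℕ
  budget avL = 2 * d ^ length avL

  budget≥2 : ∀ avL → 2 ≤ budget avL
  budget≥2 avL = ℕP.*-monoʳ-≤ 2 (ℕP.m^n>0 d (length avL))

  -- A repetition-free run visits each candidate state
  -- at most once at its level, and each of its top-level blocks fits the
  -- budget; a repetition-free block never repeats its own label below it, so
  -- its body has one candidate label fewer.
  boundR : (avL : List Label) (avS : List State) {a : State} {b : Sym} {c : State} (X : Run a b c) → SimpleR X →
           (∀ {q t q'} → OccR {q} {t} {q'} X → (q , t , q') ∈ avL) →
           (∀ {s} → Visits s X → s ∈ avS) →
           length (edgesR X) + budget avL ≤ length avS * budget avL
  boundB : (avL : List Label) {a : State} {b : Sym} {c : State} (B : Block a b c) → SimpleB B →
           (∀ {q t q'} → OccB {q} {t} {q'} B → (q , t , q') ∈ avL) →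
           length (edgesB B) ≤ budget avL
  boundR avL avS done _ _ vis = ≤-length* (vis now) (budget avL)
  boundR avL avS (stay m X) (¬v , simple) occ vis =
    spend avS (vis now) 1 (length (edgesR X)) (budget avL) (ℕP.≤-trans (s≤s z≤n) (budget≥2 avL))
      (boundR avL (avS ─ vis now) X simple (occ ∘ afterStay)
         (λ v → ∈-─ (vis now) (vis (laterStay v)) (λ e → ¬v (subst (λ s → Visits s X) e v))))
  boundR avL avS (nest B X) (¬v , simpleB , simple) occ vis =
    subst (λ n → n + budget avL ≤ length avS * budget avL) (sym (length-++ (edgesB B)))
      (spend avS (vis now) (length (edgesB B)) (length (edgesR X)) (budget avL)
        (boundB avL B simpleB (occ ∘ inHead))
        (boundR avL (avS ─ vis now) X simple (occ ∘ afterNest)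
           (λ v → ∈-─ (vis now) (vis (laterNest v)) (λ e → ¬v (subst (λ s → Visits s X) e v)))))
  boundB avL {a} {b} {c} (block m X m') (¬o , simple) occ = begin
    length (edgesB (block m X m'))     ≡⟨ length-edgesB m X m' ⟩
    length (edgesR X) + 2              ≤⟨ ℕP.+-monoʳ-≤ (length (edgesR X)) (budget≥2 avL') ⟩
    length (edgesR X) + budget avL'    ≤⟨ body ⟩
    length allStates * budget avL'     ≡⟨ cong (_* budget avL') length-allStates ⟩
    d * budget avL'                    ≡⟨ one-label-less ⟩
    budget avL                         ∎
    where
      open ℕP.≤-Reasoning
      own : (a , b , c) ∈ avL
      own = occ self
      avL' : List Label
      avL' = avL ─ own
      body : length (edgesR X) + budget avL' ≤ length allStates * budget avL'
      body = boundR avL' allStates X simple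
               (λ o → ∈-─ own (occ (inside o)) (λ e → ¬o (subst (λ { (q , t , q') → OccR {q} {t} {q'} X }) e o)))
               (λ {s} _ → ∈-allFin s)
      one-label-less : d * budget avL' ≡ budget avL
      one-label-less = trans (x∙yz≈y∙xz d 2 (d ^ length avL'))
                         (cong (λ n → 2 * d ^ n) (sym (length-─ avL own)))

  allLabels : List Label
  allLabels = cartesianProduct allStates (cartesianProduct (allFin (nΓ A)) allStates)

  length-allLabels : length allLabels ≡ d * (nΓ A * d)
  length-allLabels = trans (length-cartesianProduct allStates _)
    (cong₂ _*_ length-allStates (trans (length-cartesianProduct (allFin (nΓ A)) allStates)
                                       (cong₂ _*_ (length-tabulate {n = nΓ A} (λ x → x)) length-allStates)))

  allPairs : List (State × Sym)
  allPairs = cartesianProduct allStates (allFin (nΓ A))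

  length-allPairs : length allPairs ≡ d * nΓ A
  length-allPairs = trans (length-cartesianProduct allStates _) (cong₂ _*_ length-allStates (length-tabulate {n = nΓ A} (λ x → x)))

  budget₀ : ℕ
  budget₀ = budget allLabels

  runMax : ℕ
  runMax = (d ∸ 1) * budget₀

  simpleBlock-short : ∀ {a b c} (B : Block a b c) → SimpleB B → length (edgesB B) ≤ budget₀
  simpleBlock-short B simple = boundB allLabels B simple (λ {q} {t} {q'} _ → ∈-cartesianProduct⁺ (∈-allFin q) (∈-cartesianProduct⁺ (∈-allFin t) (∈-allFin q')))

  simpleRun-short : ∀ {a b c} (X : Run a b c) → SimpleR X → length (edgesR X) + budget₀ ≤ d * budget₀
  simpleRun-short X simple =
    subst (λ n → length (edgesR X) + budget₀ ≤ n * budget₀) length-allStates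
      (boundR allLabels allStates X simple
         (λ {q} {t} {q'} _ → ∈-cartesianProduct⁺ (∈-allFin q) (∈-cartesianProduct⁺ (∈-allFin t) (∈-allFin q')))
         (λ {s} _ → ∈-allFin s))

  simpleRun-short′ : ∀ {a b c} (X : Run a b c) → SimpleR X → length (edgesR X) ≤ runMax
  simpleRun-short′ X simple = cancel d (length (edgesR X)) (simpleRun-short X simple)
    where
      cancel : ∀ n x → .{{NonZero n}} → x + budget₀ ≤ n * budget₀ → x ≤ (n ∸ 1) * budget₀
      cancel (suc n) x le = ℕP.+-cancelˡ-≤ budget₀ x (n * budget₀) (subst (_≤ suc n * budget₀) (ℕP.+-comm x budget₀) le)

  -- A repetition-free climb passes each candidate (state, top) pair once, and
  -- each of its levels is a repetition-free run followed by a push.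
  boundC : (avP : List (State × Sym)) {a : State} {b : Sym} {c : State} {e : Sym} (U : Climb a b c e) → SimpleC U →
           (∀ {s u} → Passes s u U → (s , u) ∈ avP) → suc (length (edgesC U)) ≤ length avP * suc runMax
  boundC avP (level X) simple pass = ℕP.≤-trans (s≤s (simpleRun-short′ X simple)) (≤-length* (pass now) (suc runMax))
  boundC avP {a} {b} (rise X m U) (¬p , simpleX , simpleU) pass = begin
    suc (length (edgesR X ++ _ ∷ edgesC U))             ≡⟨ cong suc (length-++ (edgesR X)) ⟩
    suc (length (edgesR X) + suc (length (edgesC U)))   ≤⟨ s≤s (ℕP.+-monoˡ-≤ _ (simpleRun-short′ X simpleX)) ⟩
    suc runMax + suc (length (edgesC U))                ≤⟨ ℕP.+-monoʳ-≤ (suc runMax) rest ⟩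
    suc runMax + length (avP ─ pass now) * suc runMax   ≡⟨ cong (_* suc runMax) (sym (length-─ avP (pass now))) ⟩
    length avP * suc runMax                             ∎
    where
      open ℕP.≤-Reasoning
      rest : suc (length (edgesC U)) ≤ length (avP ─ pass now) * suc runMax
      rest = boundC (avP ─ pass now) U simpleU
               (λ p → ∈-─ (pass now) (pass (later p)) (λ e → ¬p (subst (λ { (s , u) → Passes s u U }) e p)))

  simpleClimb-short : ∀ {a b c e} (U : Climb a b c e) → SimpleC U → suc (length (edgesC U)) ≤ length allPairs * suc runMax
  simpleClimb-short U simple = boundC allPairs U simple (λ {s} {u} _ → ∈-cartesianProduct⁺ (∈-allFin s) (∈-allFin u))

  -- M fits the counting bounds: it dominates the length of every loop found in
  -- a repetition-free run (d · budget₀) or climb, and of every repetition-free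
  -- climb.
  record Fits (M : ℕ) : Set where
    field
      runs   : d * budget₀ ≤ M
      climbs : suc (length allPairs) * suc runMax ≤ suc M

-- For a bound M fitting the counting bounds, every derivation either contains
-- a pump family whose loop has length at most M, or is repetition-free and
-- hence short.
module Decomposition (A : PDS) (M : ℕ) (fits : Counting.Fits A M) where

  open import Data.Nat as ℕ using (ℕ; suc; _≤_; z≤n; s≤s; _+_; _*_)
  open import Data.List using (List; []; _∷_; _++_; length)
  import Data.Nat.Properties as ℕP
  open import Data.Integer as ℤ using (ℤ)
  open import Data.Integer.Tactic.RingSolver using (solve-∀)
  open import Data.List.Properties using (length-++; ++-assoc; ++-identityʳ)
  open import Data.List.Membership.Propositional using (_∈_)
  open import Data.Product using (_,_)
  open import Data.Sum using (_⊎_; inj₁; inj₂)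
  open import Data.Unit using (tt)
  open import Relation.Binary.PropositionalEquality
  open import Relation.Nullary using (yes; no)
  open WeightSum
  open Derivation A
  open Counting A
  open Fits fits

  PumpR : ∀ {a b c} → Run a b c → Set
  PumpR = PumpFamily edgesR M

  PumpB : ∀ {a b c} → Block a b c → Set
  PumpB = PumpFamily edgesB M

  PumpC : ∀ {a b c e} → Climb a b c e → Set
  PumpC = PumpFamily edgesC M

  runLoop : ∀ {a b c} (Cy : Run a b a) (Y : Run a b c) →
            1 ≤ length (edgesR Cy) → length (edgesR Cy) ≤ M → PumpR (Cy ++ᴿ Y)
  runLoop Cy Y = iterated (Cy ++ᴿ_) Y (edgesR Cy) (prepends edgesR (Cy ++ᴿ_) (edgesR Cy) (edgesR-++ Cy)) refl

  climbLoop : ∀ {a b c e} (Cy : Climb a b a b) (Y : Climb a b c e) →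
              1 ≤ length (edgesC Cy) → length (edgesC Cy) ≤ M → PumpC (Cy ++ᶜ Y)
  climbLoop Cy Y = iterated (Cy ++ᶜ_) Y (edgesC Cy) (prepends edgesC (Cy ++ᶜ_) (edgesC Cy) (edgesC-++ Cy)) refl

  -- In the block case the loop is the outer block around the inner occurrence,
  -- and the context replaces the inner occurrence by its argument.
  blockLoop : ∀ {a b p z p' c} (m : edge a b p (push z) ∈ E A) (X : Run p z p') (m' : edge p' z c pop ∈ E A) →
              OccR {a} {b} {c} X → length (edgesB (block m X m')) ≤ M → PumpB (block m X m')
  blockLoop {a} {b} {p} {z} {p'} {c} m X m' o short =
    iterated wrap inner EO adds wrap-inner (s≤s z≤n)
      (ℕP.≤-trans (subst (λ B → length EO ≤ length (edgesB B)) wrap-inner EO≤) short)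
    where
      e e' : Ed
      e  = edge a b p (push z)
      e' = edge p' z c pop
      wrap : Block a b c → Block a b c
      wrap B' = block m (replaceR X o B') m'
      inner : Block a b c
      inner = extractR X o
      wrap-inner : wrap inner ≡ block m X m'
      wrap-inner = cong (λ Y → block m Y m') (replaceR-extract X o)
      EO : List Ed
      EO = e ∷ (beforeR X o ++ afterR X o ++ e' ∷ [])
      adds : ∀ (f : Ed → ℤ) B' → wsum f (edgesB (wrap B')) ≡ wsum f EO ℤ.+ wsum f (edgesB B')
      adds f B' = begin
          f e ℤ.+ wsum f (edgesR (replaceR X o B') ++ e' ∷ [])
            ≡⟨ cong (λ l → f e ℤ.+ wsum f (l ++ e' ∷ [])) (replaceR-edges X o B') ⟩
          f e ℤ.+ wsum f ((bef ++ mid ++ aft) ++ e' ∷ [])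
            ≡⟨ cong (ℤ._+_ (f e)) (trans (wsum-++ f (bef ++ mid ++ aft) (e' ∷ []))
                 (cong (ℤ._+ wsum f (e' ∷ [])) (trans (wsum-++ f bef (mid ++ aft)) (cong (ℤ._+_ (wsum f bef)) (wsum-++ f mid aft))))) ⟩
          f e ℤ.+ ((wsum f bef ℤ.+ (wsum f mid ℤ.+ wsum f aft)) ℤ.+ wsum f (e' ∷ []))
            ≡⟨ move-out (f e) (wsum f bef) (wsum f mid) (wsum f aft) (wsum f (e' ∷ [])) ⟩
          f e ℤ.+ (wsum f bef ℤ.+ (wsum f aft ℤ.+ wsum f (e' ∷ []))) ℤ.+ wsum f mid
            ≡⟨ cong (λ w → f e ℤ.+ w ℤ.+ wsum f mid) (sym (trans (wsum-++ f bef (aft ++ e' ∷ [])) (cong (ℤ._+_ (wsum f bef)) (wsum-++ f aft (e' ∷ []))))) ⟩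
          wsum f EO ℤ.+ wsum f mid ∎
        where
          open ≡-Reasoning
          bef aft mid : List Ed
          bef = beforeR X o
          aft = afterR X o
          mid = edgesB B'
          move-out : ∀ x u v w y → x ℤ.+ ((u ℤ.+ (v ℤ.+ w)) ℤ.+ y) ≡ x ℤ.+ (u ℤ.+ (w ℤ.+ y)) ℤ.+ v
          move-out = solve-∀
      EO≤ : length EO ≤ length (edgesB (wrap inner))
      EO≤ = subst (length EO ≤_) (sym (wsum-length {xs = edgesB (wrap inner)} {ys = EO} {zs = edgesB inner} (λ f → adds f inner))) (ℕP.m≤m+n (length EO) _)

  prefixR-shorter : ∀ {a b s c} {X₁ : Run a b s} {X₂ : Run s b c} {X : Run a b c} →
                    X₁ ++ᴿ X₂ ≡ X → length (edgesR X₁) ≤ length (edgesR X)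
  prefixR-shorter {X₁ = X₁} {X₂} refl =
    subst (length (edgesR X₁) ≤_) (sym (trans (cong length (edgesR-++ X₁ X₂)) (length-++ (edgesR X₁))))
      (ℕP.m≤m+n _ _)

  prefixC-shorter : ∀ {a b s u c e} {U₁ : Climb a b s u} {U₂ : Climb s u c e} {U : Climb a b c e} →
                    U₁ ++ᶜ U₂ ≡ U → length (edgesC U₁) ≤ length (edgesC U)
  prefixC-shorter {U₁ = U₁} {U₂} refl =
    subst (length (edgesC U₁) ≤_) (sym (trans (cong length (edgesC-++ U₁ U₂)) (length-++ (edgesC U₁))))
      (ℕP.m≤m+n _ _)

  revisit-fits : ∀ {a b s c} {X₁ : Run a b s} {X₂ : Run s b c} {X : Run a b c} h →
                 h ≤ budget₀ → X₁ ++ᴿ X₂ ≡ X → SimpleR X → h + length (edgesR X₁) ≤ M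
  revisit-fits {X₁ = X₁} {X₂} {X} h h≤ eq simple = begin
    h + length (edgesR X₁)        ≤⟨ ℕP.+-mono-≤ h≤ (prefixR-shorter {X₁ = X₁} {X₂} eq) ⟩
    budget₀ + length (edgesR X)   ≡⟨ ℕP.+-comm budget₀ _ ⟩
    length (edgesR X) + budget₀   ≤⟨ simpleRun-short X simple ⟩
    d * budget₀                   ≤⟨ runs ⟩
    M                             ∎
    where
      open ℕP.≤-Reasoning

  decomposeR : ∀ {a b c} (X : Run a b c) → PumpR X ⊎ SimpleR X
  decomposeB : ∀ {a b c} (B : Block a b c) → PumpB B ⊎ SimpleB B
  decomposeR done = inj₂ tt
  decomposeR (stay m X) with decomposeR X
  ... | inj₁ F = inj₁ (embed (stay m) (_ ∷ []) [] (λ Y → cong (_ ∷_) (sym (++-identityʳ (edgesR Y)))) F)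
  decomposeR {a} (stay m X) | inj₂ simple with visits? a X
  ... | no ¬v = inj₂ (¬v , simple)
  ... | yes v with splitRun X v
  ...   | X₁ , X₂ , eq = inj₁ (subst PumpR (cong (stay m) eq)
            (runLoop (stay m X₁) X₂ (s≤s z≤n) (revisit-fits {X₁ = X₁} {X₂} 1 (ℕP.≤-trans (s≤s z≤n) (budget≥2 allLabels)) eq simple)))
  decomposeR (nest B X) with decomposeB B
  ... | inj₁ F = inj₁ (embed (λ B' → nest B' X) [] (edgesR X) (λ _ → refl) F)
  ... | inj₂ simpleB with decomposeR X
  ...   | inj₁ F = inj₁ (embed (nest B) (edgesB B) [] (λ Y → cong (edgesB B ++_) (sym (++-identityʳ (edgesR Y)))) F)
  decomposeR {a} (nest B X) | inj₂ simpleB | inj₂ simple with visits? a X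
  ... | no ¬v = inj₂ (¬v , simpleB , simple)
  ... | yes v with splitRun X v
  ...   | X₁ , X₂ , eq = inj₁ (subst PumpR (cong (nest B) eq)
            (runLoop (nest B X₁) X₂ (block-first B (edgesR X₁))
               (subst (_≤ M) (sym (length-++ (edgesB B)))
                  (revisit-fits {X₁ = X₁} {X₂} (length (edgesB B)) (simpleBlock-short B simpleB) eq simple))))
    where
      block-first : ∀ {a b c} (B : Block a b c) l → 1 ≤ length (edgesB B ++ l)
      block-first (block _ _ _) l = s≤s z≤n
  decomposeB (block m X m') with decomposeR X
  ... | inj₁ F = inj₁ (embed (λ X' → block m X' m') (_ ∷ []) (_ ∷ []) (λ _ → refl) F)
  decomposeB {a} {b} {c} (block m X m') | inj₂ simple with occR? a b c X
  ... | no ¬o = inj₂ (¬o , simple)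
  ... | yes o = inj₁ (blockLoop m X m' o block-fits)
    where
      open ℕP.≤-Reasoning
      block-fits : length (edgesB (block m X m')) ≤ M
      block-fits = begin
        length (edgesB (block m X m'))   ≡⟨ length-edgesB m X m' ⟩
        length (edgesR X) + 2            ≤⟨ ℕP.+-monoʳ-≤ (length (edgesR X)) (budget≥2 allLabels) ⟩
        length (edgesR X) + budget₀      ≤⟨ simpleRun-short X simple ⟩
        d * budget₀                      ≤⟨ runs ⟩
        M                                ∎

  rise-fits : ∀ {a b p p' z c e} {X : Run a b p} (m : edge p b p' (push z) ∈ E A)
                {U₁ : Climb p' z a b} {U₂ : Climb a b c e} {U : Climb p' z c e} →
              SimpleR X → SimpleC U → U₁ ++ᶜ U₂ ≡ U → length (edgesC (rise X m U₁)) ≤ M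
  rise-fits {p = p} {p'} {z} {X = X} m {U₁} {U₂} {U} simpleX simpleU eq = ℕP.≤-pred (begin
    suc (length (edgesR X ++ _ ∷ edgesC U₁))          ≡⟨ cong suc (length-++ (edgesR X)) ⟩
    suc (length (edgesR X) + suc (length (edgesC U₁))) ≤⟨ s≤s (ℕP.+-mono-≤ (simpleRun-short′ X simpleX) (s≤s (prefixC-shorter {U₁ = U₁} {U₂} eq))) ⟩
    suc runMax + suc (length (edgesC U))               ≤⟨ ℕP.+-monoʳ-≤ (suc runMax) (simpleClimb-short U simpleU) ⟩
    suc (length allPairs) * suc runMax                 ≤⟨ climbs ⟩
    suc M                                              ∎)
    where open ℕP.≤-Reasoning

  decomposeC : ∀ {a b c e} (U : Climb a b c e) → PumpC U ⊎ SimpleC U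
  decomposeC (level X) with decomposeR X
  ... | inj₁ F      = inj₁ (embed level [] [] (λ Y → sym (++-identityʳ (edgesR Y))) F)
  ... | inj₂ simple = inj₂ simple
  decomposeC (rise X m U) with decomposeC U
  ... | inj₁ F = inj₁ (embed (rise X m) (edgesR X ++ _ ∷ []) []
                   (λ V → trans (cong (λ w → edgesR X ++ _ ∷ w) (sym (++-identityʳ (edgesC V))))
                                (sym (++-assoc (edgesR X) (_ ∷ []) _))) F)
  ... | inj₂ simpleU with decomposeR X
  ...   | inj₁ F = inj₁ (embed (λ X' → rise X' m U) [] (_ ∷ edgesC U) (λ _ → refl) F)
  decomposeC {a} {b} (rise X m U) | inj₂ simpleU | inj₂ simpleX with passes? a b U
  ... | no ¬p = inj₂ (¬p , simpleX , simpleU)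
  ... | yes p with splitClimb U p
  ...   | U₁ , U₂ , eq = inj₁ (subst PumpC (cong (rise X m) eq)
            (climbLoop (rise X m U₁) U₂ (rise-first (edgesR X)) (rise-fits m {U₁} {U₂} simpleX simpleU eq)))
    where
      rise-first : ∀ {e} l {r} → 1 ≤ length (l ++ e ∷ r)
      rise-first {e} l {r} = subst (1 ≤_) (sym (length-++ l)) (ℕP.≤-trans (s≤s z≤n) (ℕP.m≤n+m (suc (length r)) (length l)))

  shortOrPumpable : ∀ {a b c e} (U : Climb a b c e) → PumpC U ⊎ length (edgesC U) ≤ M
  shortOrPumpable U with decomposeC U
  ... | inj₁ F      = inj₁ F
  ... | inj₂ simple = inj₂ (ℕP.≤-pred (ℕP.≤-trans (simpleClimb-short U simple)
                                        (ℕP.≤-trans (ℕP.m≤n+m _ (suc runMax)) climbs)))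

-- The pumping lemma for positive cycles, for integer edge weights w and a
-- bound 1 + m (playing the role of 1/ε) fitting the counting bounds.
module PositiveCycles (A : PDS) (m : ℕ) (fits : Counting.Fits A (suc m))
  (w : Edge (nQ A) (nΓ A) → ℤ) where

  open import Data.Nat as ℕ using (ℕ; suc)
  open import Data.Integer as ℤ using (ℤ)
  open import Data.List using (length)
  import Data.Nat.Properties as ℕP
  open import Data.Nat.Induction using (<-wellFounded)
  open import Induction.WellFounded using (Acc; acc)
  open import Data.Integer using (+_; _<_)
  import Data.Integer.Properties as ℤP
  open import Data.Product using (Σ; _,_)
  open import Data.Sum using (inj₁; inj₂)
  open import Relation.Binary.PropositionalEquality
  open import Relation.Nullary using (yes; no)
  open WeightSum
  open ScaledWeight
  open Derivation A
  open Decomposition A (suc m) fits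

  PositiveCycle : ℤ → ℕ → Set
  PositiveCycle p q = Σ State λ a → Σ Sym λ b → Σ (Climb a b a b) λ C → + 0 < scaled w p q (edgesC C)

  -- If the cycle is short it works
  -- itself.  Otherwise it contains a pump family; if the loop-free remainder
  -- is still ε-positive we recurse on it, and if not, the loop must carry the
  -- positivity, so its weight is nonnegative and pumping it often enough wins.
  pump-positive : ∀ {a b} (C : Climb a b a b) → + 0 < scaled w (+ 1) m (edgesC C) →
                  ∀ p q → PositiveCycle (+ suc p) q
  pump-positive C pos p q = go C (<-wellFounded (length (edgesC C))) pos
    where
      go : ∀ {a b} (C : Climb a b a b) → Acc ℕ._<_ (length (edgesC C)) →
           + 0 < scaled w (+ 1) m (edgesC C) → PositiveCycle (+ suc p) q
      go C (acc smaller) pos with shortOrPumpable C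
      ... | inj₂ short = _ , _ , C , short-positive (wsum w (edgesC C)) m (length (edgesC C)) p q short pos
      ... | inj₁ F with ℤP._<?_ (+ 0) (scaled w (+ 1) m (edgesC (PumpFamily.member F 0)))
      ...   | yes pos₀ = go (member 0) (smaller remainder-shorter) pos₀
        where
          open PumpFamily F
          remainder-shorter : length (edgesC (member 0)) ℕ.< length (edgesC C)
          remainder-shorter = subst (length (edgesC (member 0)) ℕ.<_) (sym split-length)
                                (ℕP.+-monoˡ-≤ (length (edgesC (member 0))) nonempty)
      ...   | no ¬pos₀ = _ , _ , member K , subst (+ 0 <_) (sym pumped-value)
                           (pumped-positive W₀ WO n₀ nO p q loop-nonneg nonempty)
        where
          open PumpFamily F
          W₀ WO : ℤ
          W₀ = wsum w (edgesC (member 0))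
          WO = wsum w loop
          n₀ nO K : ℕ
          n₀ = length (edgesC (member 0))
          nO = length loop
          K  = pumpCount W₀ q
          loop-positive : + 0 < scaled w (+ 1) m loop
          loop-positive = positive-left _ _ (subst (+ 0 <_) (scaled-split w (+ 1) m {edgesC C} {loop} {edgesC (member 0)} split-wsum) pos) (ℤP.≮⇒≥ ¬pos₀)
          loop-nonneg : + 0 ℤ.≤ WO
          loop-nonneg = nonneg-weight WO m nO short loop-positive
          pumped-value : scaled w (+ suc p) q (edgesC (member K)) ≡ (+ K ℤ.* WO ℤ.+ W₀) ℤ.* + suc q ℤ.+ + (K ℕ.* nO ℕ.+ n₀) ℤ.* + suc p
          pumped-value = cong₂ (λ W n → W ℤ.* + suc q ℤ.+ + n ℤ.* + suc p) (member-wsum w K) (member-length K)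

-- Arithmetic: the paper's ε is small enough for the counting bounds.
module EpsilonBound where

  open import Data.Nat as ℕ using (ℕ; suc; _≤_; z≤n; s≤s; _+_; _*_; _^_; _∸_; NonZero)
  import Data.Nat.Properties as ℕP
  open import Data.Nat.Tactic.RingSolver using (solve-∀)
  open import Relation.Binary.PropositionalEquality

  bigM : ℕ → ℕ
  bigM ℓ = ℓ ^ ((ℓ + 1) ^ 2) * 2 * ℓ

  -- The square in the exponent leaves room for a few extra factors ℓ.
  square-room : ∀ k → 1 ≤ k → 2 + k * k ≤ (k + 1) ^ 2
  square-room (suc j) _ = subst (2 + suc j * suc j ≤_) (sym (expand j)) (ℕP.m≤m+n _ _)
    where
      expand : ∀ j → ((1 + j) + 1) * (((1 + j) + 1) * 1) ≡ (2 + (1 + j) * (1 + j)) + (1 + 2 * j)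
      expand = solve-∀

  factor≤product : ∀ d g → 1 ≤ g → d ≤ g * d
  factor≤product d g g≥1 = subst (_≤ g * d) (ℕP.*-identityˡ d) (ℕP.*-monoˡ-≤ d g≥1)

  -- For d = |Q| ≥ 1 and g = |Γ| ≥ 1, with ℓ = g·d, let N = 2·d^(d·ℓ) be the
  -- budget of a repetition-free block (d·ℓ is the number of block labels).
  -- bigM ℓ dominates the length d·N of a run loop, and the (1 + d·g) levels
  -- of length at most 1 + (d - 1)·N of a climb loop.
  module _ (d g : ℕ) (d≥1 : 1 ≤ d) (g≥1 : 1 ≤ g) where

    private
      ℓ N L : ℕ
      ℓ = g * d
      N = 2 * d ^ (d * ℓ)
      L = ℓ ^ ((ℓ + 1) ^ 2)

      d≤ℓ : d ≤ ℓ
      d≤ℓ = factor≤product d g g≥1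

      instance
        ℓ≢0 : NonZero ℓ
        ℓ≢0 = ℕ.>-nonZero (ℕP.≤-trans d≥1 d≤ℓ)
        d≢0 : NonZero d
        d≢0 = ℕ.>-nonZero d≥1

      run-loop : d * N ≤ 2 * ℓ ^ suc (ℓ * ℓ)
      run-loop = begin
        d * (2 * d ^ (d * ℓ))   ≡⟨ swap d 2 (d ^ (d * ℓ)) ⟩
        2 * d ^ suc (d * ℓ)     ≤⟨ ℕP.*-monoʳ-≤ 2 (ℕP.^-monoˡ-≤ (suc (d * ℓ)) d≤ℓ) ⟩
        2 * ℓ ^ suc (d * ℓ)     ≤⟨ ℕP.*-monoʳ-≤ 2 (ℕP.^-monoʳ-≤ ℓ (s≤s (ℕP.*-monoˡ-≤ ℓ d≤ℓ))) ⟩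
        2 * ℓ ^ suc (ℓ * ℓ)     ∎
        where
          open ℕP.≤-Reasoning
          swap : ∀ a b c → a * (b * c) ≡ b * (a * c)
          swap = solve-∀

      bigM-≡ : 2 * (ℓ * L) ≡ bigM ℓ
      bigM-≡ = swap 2 ℓ L
        where swap : ∀ a b c → a * (b * c) ≡ c * a * b
              swap = solve-∀

    covers-runs : d * N ≤ bigM ℓ
    covers-runs = begin
      d * N                  ≤⟨ run-loop ⟩
      2 * ℓ ^ suc (ℓ * ℓ)    ≤⟨ ℕP.*-monoʳ-≤ 2 (ℕP.^-monoʳ-≤ ℓ (ℕP.≤-trans (ℕP.n≤1+n _) (square-room ℓ (ℕP.≤-trans d≥1 d≤ℓ)))) ⟩
      2 * L                  ≤⟨ ℕP.*-monoʳ-≤ 2 (ℕP.m≤n*m L ℓ) ⟩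
      2 * (ℓ * L)            ≡⟨ bigM-≡ ⟩
      bigM ℓ                 ∎
      where open ℕP.≤-Reasoning

    level-fits : suc ((d ∸ 1) * N) ≤ d * N
    level-fits = one-fewer d N d≥1 (ℕP.≤-trans (ℕP.m^n>0 d (d * ℓ)) (ℕP.m≤n*m _ 2))
      where
        one-fewer : ∀ n P → 1 ≤ n → 1 ≤ P → suc ((n ∸ 1) * P) ≤ n * P
        one-fewer (suc n) P _ P≥1 = ℕP.+-monoˡ-≤ (n * P) P≥1

    -- For ℓ ≥ 2 the factor 1 + ℓ of the climb levels is paid by two factors ℓ.
    covers-climbs-large : 2 ≤ ℓ → suc (d * g) * suc ((d ∸ 1) * N) ≤ bigM ℓ
    covers-climbs-large ℓ≥2 = begin
      suc (d * g) * suc ((d ∸ 1) * N)   ≤⟨ ℕP.*-mono-≤ (ℕP.≤-reflexive (cong suc (ℕP.*-comm d g))) level-fits ⟩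
      suc ℓ * (d * N)                   ≤⟨ ℕP.*-mono-≤ 1+ℓ≤ℓ*ℓ run-loop ⟩
      (ℓ * ℓ) * (2 * ℓ ^ suc (ℓ * ℓ))   ≡⟨ regroup ℓ (ℓ ^ suc (ℓ * ℓ)) ⟩
      2 * ℓ ^ (2 + suc (ℓ * ℓ))         ≤⟨ ℕP.*-monoʳ-≤ 2 (ℕP.^-monoʳ-≤ ℓ (s≤s (square-room ℓ (ℕP.≤-trans (s≤s z≤n) ℓ≥2)))) ⟩
      2 * (ℓ * L)                       ≡⟨ bigM-≡ ⟩
      bigM ℓ                            ∎
      where
        open ℕP.≤-Reasoning
        regroup : ∀ a x → (a * a) * (2 * x) ≡ 2 * (a * (a * x))
        regroup = solve-∀
        1+ℓ≤ℓ*ℓ : suc ℓ ≤ ℓ * ℓ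
        1+ℓ≤ℓ*ℓ = begin
          suc ℓ     ≡⟨ ℕP.+-comm 1 ℓ ⟩
          ℓ + 1     ≤⟨ ℕP.+-monoʳ-≤ ℓ (ℕP.≤-trans (s≤s z≤n) ℓ≥2) ⟩
          ℓ + ℓ     ≡⟨ cong (ℓ +_) (sym (ℕP.+-identityʳ ℓ)) ⟩
          2 * ℓ     ≤⟨ ℕP.*-monoˡ-≤ ℓ ℓ≥2 ⟩
          ℓ * ℓ     ∎

  -- The climb bound; for ℓ = 1 it holds with one to spare (2 ≤ 3).
  covers-climbs : ∀ d g → 1 ≤ d → 1 ≤ g → suc (d * g) * suc ((d ∸ 1) * (2 * d ^ (d * (g * d)))) ≤ suc (bigM (g * d))
  covers-climbs 1 1 _ _ = s≤s (s≤s z≤n)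
  covers-climbs d@(suc (suc _)) g d≥1 g≥1 =
    ℕP.≤-trans (covers-climbs-large d g d≥1 g≥1 (ℕP.≤-trans (s≤s (s≤s z≤n)) (factor≤product d g g≥1))) (ℕP.n≤1+n _)
  covers-climbs 1 g@(suc (suc _)) d≥1 g≥1 =
    ℕP.≤-trans (covers-climbs-large 1 g d≥1 g≥1 (subst (2 ≤_) (sym (ℕP.*-identityʳ g)) (s≤s (s≤s z≤n)))) (ℕP.n≤1+n _)

open import Data.Nat as ℕ using (zero; z≤n; s≤s; NonZero)
import Data.Nat.Properties as ℕP
open import Data.Integer as ℤ using (+_; -[1+_]; +<+)
open import Data.Rational as ℚ using (ℚ; 0ℚ; _<_; mkℚ; toℚᵘ)
import Data.Rational.Properties as ℚP
open import Data.Rational.Unnormalised as ℚᵘ using (mkℚᵘ; _≃_; *<*)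
import Data.Rational.Unnormalised.Properties as ℚᵘP
open import Data.Fin using (Fin)
open import Data.List using (List; []; _∷ʳ_)
open import Data.List.Properties using (++-identityʳ; ∷ʳ-injectiveʳ)
open import Data.Product using (Σ; _×_; _,_; proj₁; proj₂)
open import Function.Bundles using (_⇔_; mk⇔)
open import Relation.Binary.PropositionalEquality
open EpsilonBound

epsilon-value : ∀ ℓ → 1 ℕ.≤ ℓ → Σ ℕ λ m → bigM ℓ ≡ suc m × toℚᵘ (epsilonOf ℓ) ≃ mkℚᵘ (+ 1) m
epsilon-value (suc k) _ = reciprocal (bigM (suc k))
    {{ℕP.m*n≢0 _ _ {{ℕP.m*n≢0 _ _ {{ℕP.m^n≢0 (suc k) ((suc k ℕ.+ 1) ℕ.^ 2)}}}}}}
  where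
    reciprocal : ∀ n .{{_ : NonZero n}} → Σ ℕ λ m → n ≡ suc m × toℚᵘ (+ 1 ℚ./ n) ≃ mkℚᵘ (+ 1) m
    reciprocal (suc m) = m , refl , ℚP.toℚᵘ-fromℚᵘ (mkℚᵘ (+ 1) m)

-- The theorem for a fixed weighted system A: ε = 1/(1 + m) where 1 + m fits
-- the counting bounds, and good cycles correspond to climb cycles.
module ForSystem (A : WPS ℤ) where
  open Derivation (sys A)
  open Paths (sys A)
  open RationalWeight (w A)

  private
    inhabited : ∀ {n} → Fin n → 1 ℕ.≤ n
    inhabited {suc n} _ = s≤s z≤n
    d≥1 : 1 ℕ.≤ nQ (sys A)
    d≥1 = inhabited (q0 (sys A))
    g≥1 : 1 ℕ.≤ nΓ (sys A)
    g≥1 = inhabited (bot (sys A))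
    ε-data : Σ ℕ λ m → bigM (ell (sys A)) ≡ suc m × toℚᵘ (epsilon A) ≃ mkℚᵘ (+ 1) m
    ε-data = epsilon-value (ell (sys A)) (ℕP.≤-trans d≥1 (factor≤product _ _ g≥1))

  -- 1/ε = 1 + m.
  m : ℕ
  m = proj₁ ε-data

  ε≃ : toℚᵘ (epsilon A) ≃ mkℚᵘ (+ 1) m
  ε≃ = proj₂ (proj₂ ε-data)

  ε>0 : 0ℚ < epsilon A
  ε>0 = ℚP.toℚᵘ-cancel-< (ℚᵘP.<-respʳ-≃ (ℚᵘP.≃-sym ε≃) (*<* (+<+ (s≤s z≤n))))

  fits : Counting.Fits (sys A) (suc m)
  fits = record
    { runs   = subst₂ ℕ._≤_ (cong (λ n → d ℕ.* (2 ℕ.* d ℕ.^ n)) (sym (Counting.length-allLabels (sys A))))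
                 M≡ (covers-runs d g d≥1 g≥1)
    ; climbs = subst₂ (λ p n → suc p ℕ.* suc ((d ℕ.∸ 1) ℕ.* (2 ℕ.* d ℕ.^ n)) ℕ.≤ suc (suc m))
                 (sym (Counting.length-allPairs (sys A))) (sym (Counting.length-allLabels (sys A)))
                 (subst (λ M → suc (d ℕ.* g) ℕ.* suc ((d ℕ.∸ 1) ℕ.* (2 ℕ.* d ℕ.^ (d ℕ.* (g ℕ.* d)))) ℕ.≤ suc M)
                        M≡ (covers-climbs d g d≥1 g≥1)) }
    where
      d g : ℕ
      d = nQ (sys A)
      g = nΓ (sys A)
      M≡ : bigM (ell (sys A)) ≡ suc m
      M≡ = proj₁ (proj₂ ε-data)

  open PositiveCycles (sys A) m fits (w A) using (pump-positive) public

  weight-shifted : ∀ r {c c'} (π : Path (sys A) c c') → weight (shift A r) π ≡ shiftedWeight r (pathEdges π)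
  weight-shifted r [] = refl
  weight-shifted r (_∷_ {e = e} s π) = cong (((w A e ℚ./ 1) ℚ.+ r) ℚ.+_) (weight-shifted r π)

  -- Good cycles are exactly the climbs from (q, t) back to (q, t).
  climb⇒goodCycle : ∀ r {q t} (U : Climb q t q t) → 0ℚ < shiftedWeight r (edgesC U) → HasGoodCycle (shift A r)
  climb⇒goodCycle r {q} {t} U pos with realizeC [] U
  ... | b , π , edges , above = record
    { α₁ = [] ∷ʳ t ; αₙ = b ∷ʳ t ; q = q ; path = π
    ; positive = subst (0ℚ <_) (sym (trans (weight-shifted r π) (cong (shiftedWeight r) edges))) pos
    ; localMin = above
    ; sameTop = t , [] , b , refl , refl }

  goodCycle⇒climb : ∀ r → HasGoodCycle (shift A r) →
                    Σ State λ q → Σ Sym λ t → Σ (Climb q t q t) λ U → 0ℚ < shiftedWeight r (edgesC U)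
  goodCycle⇒climb r record { q = q ; path = π ; positive = pos ; localMin = above ; sameTop = γ , a , b , refl , refl }
    with Parse.parse q γ a Parse.bottom done π (sym (++-identityʳ _)) above
  ... | record { climb = U ; ends = ends ; topped = b' , top ; edges = edges }
    with cong proj₂ ends | ∷ʳ-injectiveʳ b b' (trans (cong proj₁ ends) top)
  ... | refl | refl = q , γ , U , subst (λ es → 0ℚ < shiftedWeight r es) (sym edges)
                                   (subst (0ℚ <_) (weight-shifted r π) pos)

lemma13 : (A : WPS ℤ) →
    HasGoodCycle (shift A (epsilon A)) ⇔ ((δ : ℚ) → 0ℚ < δ → HasGoodCycle (shift A δ))
lemma13 A = mk⇔ ε⇒every (λ every → every (epsilon A) ε>0)
  where
    open ForSystem A
    open RationalWeight (w A)
    open Derivation (sys A) using (edgesC)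
    ε⇒every : HasGoodCycle (shift A (epsilon A)) → (δ : ℚ) → 0ℚ < δ → HasGoodCycle (shift A δ)
    ε⇒every gc δ@(mkℚ (+ suc p) q _) _ with goodCycle⇒climb (epsilon A) gc
    ... | _ , _ , C , C>0 with pump-positive C (positive⇒scaled (epsilon A) (edgesC C) (+ 1) m ε≃ C>0) p q
    ...   | _ , _ , D , D>0 = climb⇒goodCycle δ D (scaled⇒positive δ (edgesC D) (+ suc p) q ℚᵘP.≃-refl D>0)
    ε⇒every _ (mkℚ (+ zero) _ _) (ℚ.*<* (+<+ ()))
    ε⇒every _ (mkℚ -[1+ _ ] _ _) (ℚ.*<* ())
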